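{- Let $H$ be a simple hypergraph. Then the algebraic multiplicity of $0$ as an eigenvalue of the unified Laplacian matrix $\mathbf U^{\mathbf L}(H)$ equals the number of $DE$-components of $H$ counted with their multiplicities.
   Context: A hypergraph $H$ consists of a nonempty finite vertex set $V(H)$ and a finite multiset $E(H)$ of nonempty subsets of $V(H)$ (edges); $H$ is simple if it has no edges of cardinality $1$ and no repeated edges. A 2-partition of a set $e$ is an unordered pair $\{S_1,S_2\}$ of nonempty disjoint sets with union $e$. $I(H)$ is the set of all parts of all 2-partitions of all edges of $H$, together with all singletons $\{v\}$, $v\in V(H)$. For $S,S'\in I(H)$ write $S\sim S'$ if $\{S,S'\}$ is a 2-partition of some edge. For simple $H$, $d^*_H(S)$ is the number of $S'\in I(H)$ with $S\sim S'$; the unified Laplacian matrix $\mathbf U^{\mathbf L}(H)$ is indexed by $I(H)$ with diagonal entries $d^*_H(S)$, $(S,S')$ entry $-1$ if $S\sim S'$, and $0$ otherwise. An exact path is a sequence $S_0,e_1,S_1,\dots,e_n,S_n$ with $e_i\in E(H)$, $\{S_{i-1},S_i\}$ a 2-partition of $e_i$, and $S_0,\dots,S_n$ distinct; it joins $S_0$ and $S_n$. Define the relation $\rho$ on $I(H)$ by $S\,\rho\,S'$ iff $S=S'$ or $S$ and $S'$ are joined by an exact path; it is an equivalence relation, with class $[S]$. For $D\subseteq I(H)$, the exact subhypergraph induced by $D$ is the subhypergraph of $H$ formed by all edges of all exact paths joining distinct elements of $D$ whose parts all lie in $D$, together with the vertices $v$ with $\{v\}\in D$. The $DE$-component corresponding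 to $[S]$ is the exact subhypergraph induced by $[S]$. A $DE$-component has multiplicity $t$ if it corresponds to exactly $t$ distinct equivalence classes of $\rho$; "the number of $DE$-components counted with multiplicities" is the sum of multiplicities over distinct $DE$-components. -}

module Defs where

open import Data.Nat using (ℕ; zero; suc; _<_)
open import Data.Integer using (ℤ; +_; -_; _+_; _*_)
open import Data.Bool using (Bool)
import Data.Bool.Properties as BoolP
open import Data.Fin using (Fin; zero; suc; toℕ; punchIn; _≟_)
open import Data.Fin.Subset using (Subset; _∩_; _∪_; ⁅_⁆; Nonempty; Empty)
open import Data.Fin.Subset.Properties using (nonempty?)
open import Data.Vec using (Vec)
import Data.Vec.Properties as VecP
open import Data.List using (List; []; _∷_; length; filter)
open import Data.List.Membership.Propositional using (_∈_)
import Data.List.Membership.DecPropositional as DecMem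
open import Data.List.Relation.Unary.All using (All)
open import Data.List.Relation.Unary.Any using (Any)
open import Data.List.Relation.Unary.AllPairs using (AllPairs)
open import Data.List.Relation.Unary.Unique.Propositional using (Unique)
open import Data.Product using (Σ; ∃; _×_; _,_; ∃-syntax)
open import Data.Sum using (_⊎_)
open import Relation.Nullary using (¬_; Dec; yes; no)
open import Relation.Nullary.Decidable using (_×-dec_; ¬?)
open import Relation.Binary.PropositionalEquality using (_≡_)

-- Hypergraphs on the vertex set Fin n; the edge multiset is a list of
-- subsets of Fin n.

Hypergraph : ℕ → Set
Hypergraph n = List (Subset n)

Simple : ∀ {n} → Hypergraph n → Set
Simple E = All (λ e → 2 Data.Nat.≤ Data.Fin.Subset.∣ e ∣) E × Unique E

TwoPartition : ∀ {n} → Subset n → Subset n → Subset n → Set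
TwoPartition S S' e = Nonempty S × Nonempty S' × Empty (S ∩ S') × (S ∪ S') ≡ e

Sim : ∀ {n} → Hypergraph n → Subset n → Subset n → Set
Sim E S S' = Σ (Subset _) λ e → e ∈ E × TwoPartition S S' e

sim? : ∀ {n} (E : Hypergraph n) (S S' : Subset n) → Dec (Sim E S S')
sim? E S S' with nonempty? S ×-dec nonempty? S' ×-dec ¬? (nonempty? (S ∩ S')) | DecMem._∈?_ (VecP.≡-dec BoolP._≟_) (S ∪ S') E
... | yes (a , b , c) | yes m = yes (S ∪ S' , m , a , b , c , _≡_.refl)
... | no ¬p | _ = no λ { (e , m , a , b , c , eq) → ¬p (a , b , c) }
... | yes _ | no ¬m = no λ { (e , m , a , b , c , _≡_.refl) → ¬m m }

InI : ∀ {n} → Hypergraph n → Subset n → Set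
InI {n} E S = (Σ (Fin n) λ v → S ≡ ⁅ v ⁆) ⊎ (Σ (Subset n) λ S' → Sim E S S')

IsEnumI : ∀ {n} → Hypergraph n → List (Subset n) → Set
IsEnumI E idx = Unique idx × (∀ S → (S ∈ idx → InI E S) × (InI E S → S ∈ idx))

lookupL : ∀ {A : Set} (xs : List A) → Fin (length xs) → A
lookupL (x ∷ xs) zero = x
lookupL (x ∷ xs) (suc i) = lookupL xs i

dstar : ∀ {n} → Hypergraph n → List (Subset n) → Subset n → ℕ
dstar E idx S = length (filter (sim? E S) idx)

UL : ∀ {n} (E : Hypergraph n) (idx : List (Subset n)) →
     Fin (length idx) → Fin (length idx) → ℤ
UL E idx i j with i ≟ j
... | yes _ = + dstar E idx (lookupL idx i)
... | no _ with sim? E (lookupL idx i) (lookupL idx j)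
...   | yes _ = - (+ 1)
...   | no _ = + 0

-- Polynomials over ℤ as coefficient lists (lowest degree first)

Poly : Set
Poly = List ℤ

_+p_ : Poly → Poly → Poly
[] +p q = q
(a ∷ p) +p [] = a ∷ p
(a ∷ p) +p (b ∷ q) = (a + b) ∷ (p +p q)

scale : ℤ → Poly → Poly
scale c [] = []
scale c (a ∷ p) = (c * a) ∷ scale c p

_*p_ : Poly → Poly → Poly
[] *p q = []
(a ∷ p) *p q = scale a q +p (+ 0 ∷ (p *p q))

coeff : Poly → ℕ → ℤ
coeff [] _ = + 0
coeff (a ∷ p) zero = a
coeff (a ∷ p) (suc i) = coeff p i

sumFin : ∀ m → (Fin m → Poly) → Poly
sumFin zero f = []
sumFin (suc m) f = f zero +p sumFin m (λ j → f (suc j))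

sgn : ℕ → ℤ
sgn zero = + 1
sgn (suc k) = - sgn k

det : ∀ m → (Fin m → Fin m → Poly) → Poly
det zero A = + 1 ∷ []
det (suc m) A = sumFin (suc m) λ j →
  scale (sgn (toℕ j)) (A zero j *p det m (λ r c → A (suc r) (punchIn j c)))

charPoly : ∀ m → (Fin m → Fin m → ℤ) → Poly
charPoly m M = det m λ i j → diag i j
  where
  diag : Fin m → Fin m → Poly
  diag i j with i ≟ j
  ... | yes _ = - M i j ∷ + 1 ∷ []
  ... | no _ = - M i j ∷ []

RootMult0 : Poly → ℕ → Set
RootMult0 p k = (∀ i → i < k → coeff p i ≡ + 0) × ¬ (coeff p k ≡ + 0)

AlgMult0 : ∀ m → (Fin m → Fin m → ℤ) → ℕ → Set
AlgMult0 m M k = RootMult0 (charPoly m M) k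

data Walk {n} (E : Hypergraph n) : Subset n → Subset n → List (Subset n) → Set where
  stop : ∀ {S} → Walk E S S (S ∷ [])
  step : ∀ {S U T xs} → Sim E S U → Walk E U T xs → Walk E S T (S ∷ xs)

ExactPath : ∀ {n} → Hypergraph n → Subset n → Subset n → Set
ExactPath E S T = Σ (List (Subset _)) λ xs → Walk E S T xs × Unique xs

ρ : ∀ {n} → Hypergraph n → Subset n → Subset n → Set
ρ E S T = S ≡ T ⊎ ExactPath E S T

-- the number of ρ-equivalence classes of I(H) is k: there is a system of
-- k representatives, one from each class
NumClasses : ∀ {n} → Hypergraph n → ℕ → Set
NumClasses {n} E k = Σ (List (Subset n)) λ reps →
  length reps ≡ k × All (InI E) reps ×
  AllPairs (λ a b → ¬ ρ E a b) reps ×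
  (∀ S → InI E S → Any (ρ E S) reps)

{-# OPTIONS --safe #-}
module Submission where

-- Let m = |I(H)| and L = U^L(H). L is the Laplacian of the graph G on I(H) whose edges
-- are the pairs S ∼ S′; exact paths are the simple paths of G, so the ρ-classes are the connected
-- components of G. Let c be their number. The coefficient of x^k in det(xI − L) is (−1)^(m−k) times
-- the sum of the principal minors of L obtained by deleting a k-set s of rows and columns. Such a minor
-- vanishes when s misses a component, since the indicator vector of that component lies in its kernel.
-- When s meets every component the minor is positive: its quadratic form is positive definite because
-- 2 vᵀLv = Σ_{i∼j} (v_i − v_j)², and a positive definite integer matrix has positive determinant (by
-- induction, via the Schur complement). A set meeting every component has at least c elements and a
-- transversal has exactly c, so the coefficients below x^c vanish and the coefficient of x^c does not.

open import Defs
open import Algebra.Bundles using (CommutativeRing)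
open import Data.Fin using (Fin)
open import Data.List using (List; length)
open import Data.Fin.Subset using (Subset)
open import Relation.Nullary using (Dec)

module Determinant {c ℓ} (R : CommutativeRing c ℓ) where

  open import Level using (_⊔_)
  open import Data.Nat as ℕ using (ℕ; zero; suc)
  import Data.Nat.Properties as ℕₚ
  open import Data.Fin as Fin using (zero; suc; toℕ; punchIn; punchOut; inject₁; _≟_)
  import Data.Fin.Properties as Finₚ
  open import Data.Fin.Subset using (inside; outside; ∣_∣; ∁)
  open import Data.Vec using ([]; _∷_; lookup)
  open import Data.Bool using (Bool; true; false; if_then_else_)
  open import Data.List using (List; []; _∷_; allFin)
  open import Data.List.Membership.Propositional using (_∈_)
  open import Data.List.Membership.Propositional.Properties using (∈-allFin)
  open import Data.List.Relation.Unary.Any using (here; there)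
  open import Data.List.Relation.Unary.All using (All; []; _∷_)
  open import Data.List.Relation.Unary.Unique.Propositional using (Unique; []; _∷_)
  import Data.List.Relation.Unary.Unique.Propositional.Properties as Uniqueₚ
  open import Data.Product using (∃-syntax; _×_; _,_)
  open import Data.Sum using (_⊎_; inj₁; inj₂)
  open import Data.Empty using (⊥-elim)
  open import Function using (_∘_)
  open import Relation.Nullary using (yes; no)
  open import Relation.Binary.Definitions using (tri<; tri≈; tri>)
  open import Relation.Binary.PropositionalEquality as ≡ using (_≡_; _≢_)

  open CommutativeRing R renaming (Carrier to X; zero to *-zero)
  open import Algebra.Properties.Semiring.Sum semiring public
    using (sum; sum-syntax; sum-cong-≋; ∑-distrib-+; ∑-comm; *-distribˡ-sum; *-distribʳ-sum)
  open import Algebra.Properties.Semiring.Sum semiring using (sum-remove; sum-replicate-zero)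
  open import Algebra.Properties.Ring ring using (-‿distribˡ-*)
  open import Algebra.Properties.Group +-group using (inverseʳ-unique; ⁻¹-injective; ε⁻¹≈ε)
  open import Algebra.Solver.Ring.NaturalCoefficients.Default commutativeSemiring
    using (solve; _:=_; _:+_; _:*_)
  open import Algebra.Properties.Semiring.Exp semiring public using (_^_)
  open import Relation.Binary.Reasoning.Setoid setoid

  sum-zero : ∀ {n} (f : Fin n → X) → (∀ k → f k ≈ 0#) → sum f ≈ 0#
  sum-zero {n} f f≈0 = trans (sum-cong-≋ f≈0) (sum-replicate-zero n)

  sum-single : ∀ {n} (j : Fin n) (f : Fin n → X) → (∀ k → k ≢ j → f k ≈ 0#) → sum f ≈ f j
  sum-single {suc n} j f f≈0 = begin
    sum f                          ≈⟨ sum-remove {i = j} f ⟩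
    f j + sum (f ∘ punchIn j)      ≈⟨ +-congˡ (sum-zero _ (λ k → f≈0 _ (Finₚ.punchInᵢ≢i j k))) ⟩
    f j + 0#                       ≈⟨ +-identityʳ _ ⟩
    f j                            ∎

  Matrix : ℕ → Set c
  Matrix n = Fin n → Fin n → X

  infix 4 _≈ₘ_
  _≈ₘ_ : ∀ {n} → Matrix n → Matrix n → Set ℓ
  A ≈ₘ B = ∀ i j → A i j ≈ B i j

  sign : ℕ → X
  sign zero = 1#
  sign (suc k) = - sign k

  minor : ∀ {n} → Fin (suc n) → Matrix (suc n) → Matrix n
  minor j A r k = A (suc r) (punchIn j k)

  Det : ∀ {n} → Matrix n → X
  expansionTerm : ∀ {n} → Matrix (suc n) → Fin (suc n) → X

  Det {zero} A = 1#
  Det {suc n} A = sum (expansionTerm A)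
  expansionTerm A j = sign (toℕ j) * (A zero j * Det (minor j A))

  δ : ∀ {n} → Fin n → Fin n → X
  δ i j with i ≟ j
  ... | yes _ = 1#
  ... | no _ = 0#

  δ-≡ : ∀ {n} (i : Fin n) → δ i i ≈ 1#
  δ-≡ i with i ≟ i
  ... | yes _ = refl
  ... | no i≢i = ⊥-elim (i≢i ≡.refl)

  δ-≢ : ∀ {n} {i j : Fin n} → i ≢ j → δ i j ≈ 0#
  δ-≢ {i = i} {j} i≢j with i ≟ j
  ... | yes i≡j = ⊥-elim (i≢j i≡j)
  ... | no _ = refl

  δ-sym : ∀ {n} (i j : Fin n) → δ i j ≈ δ j i
  δ-sym i j with i ≟ j | j ≟ i
  ... | yes _ | yes _ = refl
  ... | no _ | no _ = refl
  ... | yes i≡j | no j≢i = ⊥-elim (j≢i (≡.sym i≡j))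
  ... | no i≢j | yes j≡i = ⊥-elim (i≢j (≡.sym j≡i))

  Det-cong : ∀ {n} {A B : Matrix n} → A ≈ₘ B → Det A ≈ Det B
  Det-cong {zero} A≈B = refl
  Det-cong {suc n} {A} {B} A≈B = sum-cong-≋ {x = expansionTerm A} {expansionTerm B} λ j →
    *-congˡ (*-cong (A≈B zero j) (Det-cong λ r k → A≈B (suc r) (punchIn j k)))

  Det-firstRow : ∀ {n} (A : Matrix (suc n)) → (∀ c → A zero (suc c) ≈ 0#) → Det A ≈ A zero zero * Det (minor zero A)
  Det-firstRow A row≈0 = begin
    expansionTerm A zero + sum (expansionTerm A ∘ suc)
      ≈⟨ +-congˡ (sum-zero _ λ c → trans (*-congˡ (trans (*-congʳ (row≈0 c)) (zeroˡ _))) (zeroʳ _)) ⟩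
    1# * (A zero zero * Det (minor zero A)) + 0#  ≈⟨ trans (+-identityʳ _) (*-identityˡ _) ⟩
    A zero zero * Det (minor zero A)              ∎

  SameOutsideColumn : ∀ {n} → Fin n → Matrix n → Matrix n → Set ℓ
  SameOutsideColumn j A B = ∀ i k → k ≢ j → A i k ≈ B i k

  minor-removedColumn : ∀ {n} {j : Fin (suc n)} {A B : Matrix (suc n)} →
                             SameOutsideColumn j A B → minor j A ≈ₘ minor j B
  minor-removedColumn {j = j} A~B r k = A~B (suc r) (punchIn j k) (Finₚ.punchInᵢ≢i j k)

  minor-SameOutsideColumn : ∀ {n} {j k : Fin (suc n)} {A B : Matrix (suc n)} (k≢j : k ≢ j) →
                     SameOutsideColumn j A B → SameOutsideColumn (punchOut k≢j) (minor k A) (minor k B)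
  minor-SameOutsideColumn {k = k} k≢j A~B r q q≢p =
    A~B (suc r) (punchIn k q) λ eq → q≢p (Finₚ.punchIn-injective k q _
      (≡.trans eq (≡.sym (Finₚ.punchIn-punchOut k≢j))))

  minor-punchOut : ∀ {n} {j k : Fin (suc n)} (A : Matrix (suc n)) (k≢j : k ≢ j) r →
                 minor k A r (punchOut k≢j) ≡ A (suc r) j
  minor-punchOut A k≢j r = ≡.cong (A (suc r)) (Finₚ.punchIn-punchOut k≢j)

  Det-linear : ∀ {n} (j : Fin n) (a b : X) {A B C : Matrix n} →
               SameOutsideColumn j A B → SameOutsideColumn j A C → (∀ i → A i j ≈ a * B i j + b * C i j) →
               Det A ≈ a * Det B + b * Det C
  Det-linear {suc n} j a b {A} {B} {C} A~B A~C Aj = begin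
    sum (expansionTerm A)                                            ≈⟨ sum-cong-≋ termwise ⟩
    sum (λ k → a * expansionTerm B k + b * expansionTerm C k)
      ≈⟨ ∑-distrib-+ (λ k → a * expansionTerm B k) (λ k → b * expansionTerm C k) ⟩
    sum (λ k → a * expansionTerm B k) + sum (λ k → b * expansionTerm C k)
      ≈⟨ +-cong (*-distribˡ-sum a (expansionTerm B)) (*-distribˡ-sum b (expansionTerm C)) ⟨
    a * Det B + b * Det C                                            ∎
    where
    termwise : ∀ k → expansionTerm A k ≈ a * expansionTerm B k + b * expansionTerm C k
    termwise k with k ≟ j
    ... | yes ≡.refl = begin
      s * (A zero k * dA)                             ≈⟨ *-congˡ (*-congʳ (Aj zero)) ⟩
      s * ((a * B zero k + b * C zero k) * dA)
        ≈⟨ solve 6 (λ s a b x y d → s :* ((a :* x :+ b :* y) :* d) := a :* (s :* (x :* d)) :+ b :* (s :* (y :* d)))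
                 refl s a b (B zero k) (C zero k) dA ⟩
      a * (s * (B zero k * dA)) + b * (s * (C zero k * dA))
        ≈⟨ +-cong (*-congˡ (*-congˡ (*-congˡ (Det-cong (minor-removedColumn A~B)))))
                  (*-congˡ (*-congˡ (*-congˡ (Det-cong (minor-removedColumn A~C))))) ⟩
      a * expansionTerm B k + b * expansionTerm C k   ∎
      where
      s = sign (toℕ k)
      dA = Det (minor k A)
    ... | no k≢j = begin
      s * (A zero k * Det (minor k A))                ≈⟨ *-congˡ (*-congˡ minorLinear) ⟩
      s * (A zero k * (a * dB + b * dC))
        ≈⟨ solve 6 (λ s x a b u v → s :* (x :* (a :* u :+ b :* v)) := a :* (s :* (x :* u)) :+ b :* (s :* (x :* v)))
                 refl s (A zero k) a b dB dC ⟩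
      a * (s * (A zero k * dB)) + b * (s * (A zero k * dC))
        ≈⟨ +-cong (*-congˡ (*-congˡ (*-congʳ (A~B zero k k≢j)))) (*-congˡ (*-congˡ (*-congʳ (A~C zero k k≢j)))) ⟩
      a * expansionTerm B k + b * expansionTerm C k   ∎
      where
      s = sign (toℕ k)
      dB = Det (minor k B)
      dC = Det (minor k C)
      minorLinear : Det (minor k A) ≈ a * dB + b * dC
      minorLinear = Det-linear (punchOut k≢j) a b (minor-SameOutsideColumn k≢j A~B) (minor-SameOutsideColumn k≢j A~C)
        λ r → ≡.subst (λ x → x ≈ a * minor k B r (punchOut k≢j) + b * minor k C r (punchOut k≢j))
                (≡.sym (minor-punchOut A k≢j r))
                (≡.subst₂ (λ y z → A (suc r) j ≈ a * y + b * z)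
                  (≡.sym (minor-punchOut B k≢j r)) (≡.sym (minor-punchOut C k≢j r)) (Aj (suc r)))

  Det-additive : ∀ {n} (j : Fin n) {A B C : Matrix n} →
                 SameOutsideColumn j A B → SameOutsideColumn j A C → (∀ i → A i j ≈ B i j + C i j) →
                 Det A ≈ Det B + Det C
  Det-additive j A~B A~C Aj =
    trans (Det-linear j 1# 1# A~B A~C λ i → trans (Aj i) (sym (+-cong (*-identityˡ _) (*-identityˡ _))))
          (+-cong (*-identityˡ _) (*-identityˡ _))

  Det-zeroColumn : ∀ {n} (j : Fin n) {A : Matrix n} → (∀ i → A i j ≈ 0#) → Det A ≈ 0#
  Det-zeroColumn j {A} Aj≈0 = begin
    Det A
      ≈⟨ Det-linear j 0# 0# (λ _ _ _ → refl) (λ _ _ _ → refl) (λ i → trans (Aj≈0 i) (sym 0·x+0·x≈0)) ⟩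
    0# * Det A + 0# * Det A  ≈⟨ 0·x+0·x≈0 ⟩
    0#                       ∎
    where
    0·x+0·x≈0 : ∀ {x} → 0# * x + 0# * x ≈ 0#
    0·x+0·x≈0 = trans (+-cong (zeroˡ _) (zeroˡ _)) (+-identityʳ 0#)

  SameColumns : ∀ {n} → Matrix n → Fin n → Fin n → Set ℓ
  SameColumns A j k = ∀ i → A i j ≈ A i k

  punchIn-adjacent : ∀ {n} (q : Fin (suc n)) (k : Fin (suc (suc n))) → k ≢ inject₁ q → k ≢ suc q →
                     ∃[ p ] punchIn k (inject₁ p) ≡ inject₁ q × punchIn k (suc p) ≡ suc q
  punchIn-adjacent zero zero k≢q _ = ⊥-elim (k≢q ≡.refl)
  punchIn-adjacent zero (suc zero) _ k≢q+1 = ⊥-elim (k≢q+1 ≡.refl)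
  punchIn-adjacent {suc n} zero (suc (suc k)) _ _ = zero , ≡.refl , ≡.refl
  punchIn-adjacent {suc n} (suc q) zero _ _ = q , ≡.refl , ≡.refl
  punchIn-adjacent {suc n} (suc q) (suc k) k≢q k≢q+1
    with p , eq₁ , eq₂ ← punchIn-adjacent q k (k≢q ∘ ≡.cong suc) (k≢q+1 ∘ ≡.cong suc)
    = suc p , ≡.cong suc eq₁ , ≡.cong suc eq₂

  punchIn-inject₁-suc : ∀ {n} (q c : Fin (suc n)) →
    punchIn (inject₁ q) c ≡ punchIn (suc q) c ⊎
    (punchIn (inject₁ q) c ≡ suc q × punchIn (suc q) c ≡ inject₁ q)
  punchIn-inject₁-suc zero zero = inj₂ (≡.refl , ≡.refl)
  punchIn-inject₁-suc zero (suc c) = inj₁ ≡.refl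
  punchIn-inject₁-suc {suc n} (suc q) zero = inj₁ ≡.refl
  punchIn-inject₁-suc {suc n} (suc q) (suc c) with punchIn-inject₁-suc q c
  ... | inj₁ eq = inj₁ (≡.cong suc eq)
  ... | inj₂ (eq₁ , eq₂) = inj₂ (≡.cong suc eq₁ , ≡.cong suc eq₂)

  sum-cancellingPair : ∀ {n} (q : Fin (suc n)) (f : Fin (suc (suc n)) → X) →
                       (∀ k → k ≢ inject₁ q → k ≢ suc q → f k ≈ 0#) → f (inject₁ q) + f (suc q) ≈ 0# →
                       sum f ≈ 0#
  sum-cancellingPair {n} zero f others pair = begin
    f zero + (f (suc zero) + sum (λ k → f (suc (suc k))))
      ≈⟨ +-congˡ (+-congˡ (sum-zero (λ k → f (suc (suc k))) (λ k → others (suc (suc k)) (λ ()) (λ ())))) ⟩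
    f zero + (f (suc zero) + 0#)   ≈⟨ +-congˡ (+-identityʳ _) ⟩
    f zero + f (suc zero)          ≈⟨ pair ⟩
    0#                             ∎
  sum-cancellingPair {suc n} (suc q) f others pair = begin
    f zero + sum (f ∘ suc)  ≈⟨ +-cong (others zero (λ ()) (λ ())) (sum-cancellingPair q (f ∘ suc) others′ pair) ⟩
    0# + 0#                 ≈⟨ +-identityˡ 0# ⟩
    0#                      ∎
    where
    others′ : ∀ k → k ≢ inject₁ q → k ≢ suc q → f (suc k) ≈ 0#
    others′ k k≢q k≢q+1 = others (suc k) (k≢q ∘ Finₚ.suc-injective) (k≢q+1 ∘ Finₚ.suc-injective)

  expansionTerm-vanishes : ∀ {n} (A : Matrix (suc n)) k → Det (minor k A) ≈ 0# → expansionTerm A k ≈ 0#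
  expansionTerm-vanishes A k det≈0 = trans (*-congˡ (trans (*-congˡ det≈0) (zeroʳ _))) (zeroʳ _)

  Det-adjacentEqualColumns : ∀ {n} (A : Matrix (suc n)) (q : Fin n) → SameColumns A (inject₁ q) (suc q) → Det A ≈ 0#
  Det-adjacentEqualColumns {suc n} A q Aq = sum-cancellingPair q (expansionTerm A) others pair
    where
    others : ∀ k → k ≢ inject₁ q → k ≢ suc q → expansionTerm A k ≈ 0#
    others k k≢q k≢q+1 with p , eq₁ , eq₂ ← punchIn-adjacent q k k≢q k≢q+1 =
      expansionTerm-vanishes A k (Det-adjacentEqualColumns (minor k A) p λ r →
        ≡.subst₂ (λ u v → A (suc r) u ≈ A (suc r) v) (≡.sym eq₁) (≡.sym eq₂) (Aq (suc r)))
    sameMinors : minor (inject₁ q) A ≈ₘ minor (suc q) A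
    sameMinors r c with punchIn-inject₁-suc q c
    ... | inj₁ eq = reflexive (≡.cong (A (suc r)) eq)
    ... | inj₂ (eq₁ , eq₂) =
      ≡.subst₂ (λ u v → A (suc r) u ≈ A (suc r) v) (≡.sym eq₁) (≡.sym eq₂) (sym (Aq (suc r)))
    pair : expansionTerm A (inject₁ q) + expansionTerm A (suc q) ≈ 0#
    pair = begin
      sign (toℕ (inject₁ q)) * (A zero (inject₁ q) * Det (minor (inject₁ q) A))
        + - sign (toℕ q) * (A zero (suc q) * Det (minor (suc q) A))
        ≈⟨ +-cong (*-cong (reflexive (≡.cong sign (Finₚ.toℕ-inject₁ q))) (*-cong (Aq zero) (Det-cong sameMinors)))
                  (sym (-‿distribˡ-* _ _)) ⟩
      t + - t  ≈⟨ -‿inverseʳ t ⟩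
      0#       ∎
      where t = sign (toℕ q) * (A zero (suc q) * Det (minor (suc q) A))

  column : ∀ {n} → Matrix n → Fin n → Fin n → X
  column A j i = A i j

  setColumn : ∀ {n} → Matrix n → Fin n → (Fin n → X) → Matrix n
  setColumn A j u i k with k ≟ j
  ... | yes _ = u i
  ... | no _ = A i k

  setColumn-≡ : ∀ {n} (A : Matrix n) j u i → setColumn A j u i j ≈ u i
  setColumn-≡ A j u i with j ≟ j
  ... | yes _ = refl
  ... | no j≢j = ⊥-elim (j≢j ≡.refl)

  setColumn-≢ : ∀ {n} (A : Matrix n) {j k} u i → k ≢ j → setColumn A j u i k ≈ A i k
  setColumn-≢ A {j} {k} u i k≢j with k ≟ j
  ... | yes k≡j = ⊥-elim (k≢j k≡j)
  ... | no _ = refl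

  setColumn-SameOutsideColumn : ∀ {n} (A : Matrix n) j u → SameOutsideColumn j (setColumn A j u) A
  setColumn-SameOutsideColumn A j u i k = setColumn-≢ A u i

  setColumn-SameOutsideColumn₂ : ∀ {n} (A : Matrix n) j u v → SameOutsideColumn j (setColumn A j u) (setColumn A j v)
  setColumn-SameOutsideColumn₂ A j u v i k k≢j = trans (setColumn-≢ A u i k≢j) (sym (setColumn-≢ A v i k≢j))

  setColumn-self : ∀ {n} (A : Matrix n) j → setColumn A j (column A j) ≈ₘ A
  setColumn-self A j i k with k ≟ j
  ... | yes ≡.refl = refl
  ... | no _ = refl

  inject₁≢suc : ∀ {n} (q : Fin n) → inject₁ q ≢ suc q
  inject₁≢suc (suc q) eq = inject₁≢suc q (Finₚ.suc-injective eq)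

  setAdjacentColumns : ∀ {n} → Matrix (suc n) → Fin n → (u v : Fin (suc n) → X) → Matrix (suc n)
  setAdjacentColumns A q u v = setColumn (setColumn A (inject₁ q) u) (suc q) v

  module _ {n} (A : Matrix (suc n)) (q : Fin n) where

    private
      T = setAdjacentColumns A q

    setAdjacentColumns-first : ∀ u v i → T u v i (inject₁ q) ≈ u i
    setAdjacentColumns-first u v i =
      trans (setColumn-≢ _ v i (inject₁≢suc q)) (setColumn-≡ A (inject₁ q) u i)

    setAdjacentColumns-second : ∀ u v i → T u v i (suc q) ≈ v i
    setAdjacentColumns-second u v i = setColumn-≡ _ (suc q) v i

    setAdjacentColumns-other : ∀ u v i {k} → k ≢ inject₁ q → k ≢ suc q → T u v i k ≈ A i k
    setAdjacentColumns-other u v i k≢q k≢q+1 = trans (setColumn-≢ _ v i k≢q+1) (setColumn-≢ A u i k≢q)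

    private
      _⊕_ : (u v : Fin (suc n) → X) → Fin (suc n) → X
      (u ⊕ v) i = u i + v i

      T-additiveˡ : ∀ u v w → Det (T (u ⊕ v) w) ≈ Det (T u w) + Det (T v w)
      T-additiveˡ u v w = Det-additive (inject₁ q) (sameExcept u) (sameExcept v) λ i →
        trans (setAdjacentColumns-first _ w i)
              (sym (+-cong (setAdjacentColumns-first u w i) (setAdjacentColumns-first v w i)))
        where
        sameExcept : ∀ x → SameOutsideColumn (inject₁ q) (T (u ⊕ v) w) (T x w)
        sameExcept x i k k≢q = bySecond (k ≟ suc q) k≢q
          where
          bySecond : ∀ {k} → Dec (k ≡ suc q) → k ≢ inject₁ q → T (u ⊕ v) w i k ≈ T x w i k
          bySecond (yes ≡.refl) _ = trans (setAdjacentColumns-second _ w i) (sym (setAdjacentColumns-second x w i))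
          bySecond (no k≢q+1) k≢q = trans (setAdjacentColumns-other _ w i k≢q k≢q+1)
                                          (sym (setAdjacentColumns-other x w i k≢q k≢q+1))

      T-additiveʳ : ∀ u v w → Det (T w (u ⊕ v)) ≈ Det (T w u) + Det (T w v)
      T-additiveʳ u v w = Det-additive (suc q) (setColumn-SameOutsideColumn₂ _ (suc q) _ u)
        (setColumn-SameOutsideColumn₂ _ (suc q) _ v) λ i →
        trans (setAdjacentColumns-second w _ i)
              (sym (+-cong (setAdjacentColumns-second w u i) (setAdjacentColumns-second w v i)))

      T-equal : ∀ u → Det (T u u) ≈ 0#
      T-equal u = Det-adjacentEqualColumns (T u u) q λ i →
        trans (setAdjacentColumns-first u u i) (sym (setAdjacentColumns-second u u i))

    -- Expanding det(.., u + v, u + v, ..) = 0 by additivity in both columns.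
    Det-swapAdjacent : Det (T (column A (suc q)) (column A (inject₁ q))) ≈ - Det A
    Det-swapAdjacent = inverseʳ-unique (Det A) (Det (T v u)) (begin
      Det A + Det (T v u)                                    ≈⟨ +-cong (sym (Det-cong self)) refl ⟩
      Det (T u v) + Det (T v u)                              ≈⟨ +-cong (+-identityˡ _) (+-identityʳ _) ⟨
      (0# + Det (T u v)) + (Det (T v u) + 0#)                ≈⟨ +-cong (+-congʳ (T-equal u)) (+-congˡ (T-equal v)) ⟨
      (Det (T u u) + Det (T u v)) + (Det (T v u) + Det (T v v))
        ≈⟨ +-cong (T-additiveʳ u v u) (T-additiveʳ u v v) ⟨
      Det (T u (u ⊕ v)) + Det (T v (u ⊕ v))                  ≈⟨ T-additiveˡ u v (u ⊕ v) ⟨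
      Det (T (u ⊕ v) (u ⊕ v))                                ≈⟨ T-equal (u ⊕ v) ⟩
      0#                                                     ∎)
      where
      u = column A (inject₁ q)
      v = column A (suc q)
      self : T u v ≈ₘ A
      self i k = byCases (k ≟ inject₁ q) (k ≟ suc q)
        where
        byCases : ∀ {k} → Dec (k ≡ inject₁ q) → Dec (k ≡ suc q) → T u v i k ≈ A i k
        byCases (yes ≡.refl) _ = setAdjacentColumns-first u v i
        byCases (no _) (yes ≡.refl) = setAdjacentColumns-second u v i
        byCases (no k≢q) (no k≢q+1) = setAdjacentColumns-other u v i k≢q k≢q+1

  -- Column k is moved leftwards by adjacent swaps until it sits next to column j.
  private
    equalColumns-< : ∀ d {n} (A : Matrix n) {j k : Fin n} → toℕ k ≡ d → j Fin.< k → SameColumns A j k →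
                     Det A ≈ 0#
    equalColumns-< (suc d) {suc n} A {j} {suc q} k≡d j<k Ajk with toℕ j ℕ.≟ toℕ q
    ... | yes j≡q = Det-adjacentEqualColumns A q λ i → ≡.subst (λ z → A i z ≈ A i (suc q)) j≡inject₁q (Ajk i)
      where
      j≡inject₁q : j ≡ inject₁ q
      j≡inject₁q = Finₚ.toℕ-injective (≡.trans j≡q (≡.sym (Finₚ.toℕ-inject₁ q)))
    ... | no j≢q = ⁻¹-injective (trans (sym (Det-swapAdjacent A q)) (trans swapped≈0 (sym ε⁻¹≈ε)))
      where
      B = setAdjacentColumns A q (column A (suc q)) (column A (inject₁ q))
      j<q : toℕ j ℕ.< toℕ q
      j<q = ℕₚ.≤∧≢⇒< (ℕₚ.≤-pred j<k) j≢q
      swapped≈0 : Det B ≈ 0#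
      swapped≈0 = equalColumns-< d B (≡.trans (Finₚ.toℕ-inject₁ q) (ℕₚ.suc-injective k≡d))
        (≡.subst (toℕ j ℕ.<_) (≡.sym (Finₚ.toℕ-inject₁ q)) j<q) λ i → begin
          B i j               ≈⟨ setAdjacentColumns-other A q _ _ i (λ { ≡.refl → ℕₚ.<-irrefl (Finₚ.toℕ-inject₁ q) j<q })
                                                                   (λ { ≡.refl → ℕₚ.<-irrefl ≡.refl (ℕₚ.m<n⇒m<1+n j<q) }) ⟩
          A i j               ≈⟨ Ajk i ⟩
          A i (suc q)         ≈⟨ setAdjacentColumns-first A q _ _ i ⟨
          B i (inject₁ q)     ∎

  Det-equalColumns : ∀ {n} (A : Matrix n) {j k} → j ≢ k → SameColumns A j k → Det A ≈ 0#
  Det-equalColumns A {j} {k} j≢k Ajk with Finₚ.<-cmp j k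
  ... | tri< j<k _ _ = equalColumns-< _ A ≡.refl j<k Ajk
  ... | tri≈ _ j≡k _ = ⊥-elim (j≢k j≡k)
  ... | tri> _ _ k<j = equalColumns-< _ A ≡.refl k<j (sym ∘ Ajk)

  Det-sumColumn : ∀ {n t} (A : Matrix n) (j : Fin n) (g : Fin t → Fin n → X) →
                  Det (setColumn A j (λ i → ∑[ s < t ] g s i)) ≈ ∑[ s < t ] Det (setColumn A j (g s))
  Det-sumColumn {t = zero} A j g = Det-zeroColumn j (setColumn-≡ A j _)
  Det-sumColumn {t = suc t} A j g = begin
    Det (setColumn A j (λ i → g zero i + rest i))
      ≈⟨ Det-additive j (setColumn-SameOutsideColumn₂ A j _ _) (setColumn-SameOutsideColumn₂ A j _ _) (λ i →
           trans (setColumn-≡ A j _ i) (sym (+-cong (setColumn-≡ A j (g zero) i) (setColumn-≡ A j rest i)))) ⟩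
    Det (setColumn A j (g zero)) + Det (setColumn A j rest)
      ≈⟨ +-congˡ (Det-sumColumn A j (g ∘ suc)) ⟩
    Det (setColumn A j (g zero)) + ∑[ s < t ] Det (setColumn A j (g (suc s))) ∎
    where
    rest : Fin _ → X
    rest i = ∑[ s < t ] g (suc s) i

  Det-scaleColumn : ∀ {n} (A : Matrix n) (j : Fin n) a u →
                    Det (setColumn A j (λ i → a * u i)) ≈ a * Det (setColumn A j u)
  Det-scaleColumn A j a u = trans
    (Det-linear j a 0# (setColumn-SameOutsideColumn₂ A j _ u) (setColumn-SameOutsideColumn₂ A j _ u) λ i →
      trans (setColumn-≡ A j _ i)
            (sym (trans (+-cong (*-congˡ (setColumn-≡ A j u i)) (zeroˡ _)) (+-identityʳ _))))
    (trans (+-congˡ (zeroˡ _)) (+-identityʳ _))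

  Det-combination : ∀ {n} (A : Matrix n) (j : Fin n) (w : Fin n → X) →
                    Det (setColumn A j (λ i → ∑[ k < n ] (w k * A i k))) ≈ w j * Det A
  Det-combination {n} A j w = begin
    Det (setColumn A j (λ i → ∑[ k < n ] (w k * A i k)))  ≈⟨ Det-sumColumn A j (λ k i → w k * A i k) ⟩
    ∑[ k < n ] Det (setColumn A j (λ i → w k * A i k))
      ≈⟨ sum-cong-≋ {x = λ k → Det (setColumn A j (λ i → w k * A i k))} (λ k → Det-scaleColumn A j (w k) (column A k)) ⟩
    ∑[ k < n ] (w k * Det (setColumn A j (column A k)))   ≈⟨ sum-single j _ others ⟩
    w j * Det (setColumn A j (column A j))                ≈⟨ *-congˡ (Det-cong (setColumn-self A j)) ⟩
    w j * Det A                                           ∎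
    where
    others : ∀ k → k ≢ j → w k * Det (setColumn A j (column A k)) ≈ 0#
    others k k≢j = trans (*-congˡ (Det-equalColumns _ (k≢j ∘ ≡.sym) λ i →
      trans (setColumn-≡ A j _ i) (sym (setColumn-≢ A _ i k≢j)))) (zeroʳ _)

  Det-addColumns : ∀ {n} (A : Matrix n) (j : Fin n) (a : X) (w : Fin n → X) →
                   Det (setColumn A j (λ i → a * A i j + ∑[ k < n ] (w k * A i k))) ≈ (a + w j) * Det A
  Det-addColumns {n} A j a w = begin
    Det (setColumn A j (λ i → a * A i j + combination i))
      ≈⟨ Det-linear j a 1# (setColumn-SameOutsideColumn A j _) (setColumn-SameOutsideColumn₂ A j _ combination) (λ i →
           trans (setColumn-≡ A j _ i) (+-congˡ (sym (trans (*-identityˡ _) (setColumn-≡ A j combination i))))) ⟩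
    a * Det A + 1# * Det (setColumn A j combination)  ≈⟨ +-congˡ (trans (*-identityˡ _) (Det-combination A j w)) ⟩
    a * Det A + w j * Det A                           ≈⟨ distribʳ _ a (w j) ⟨
    (a + w j) * Det A                                 ∎
    where
    combination : Fin n → X
    combination i = ∑[ k < n ] (w k * A i k)

  setColumn-cong : ∀ {n} (A : Matrix n) j {u v} → (∀ i → u i ≈ v i) → setColumn A j u ≈ₘ setColumn A j v
  setColumn-cong A j u≈v i k with k ≟ j
  ... | yes _ = u≈v i
  ... | no _ = refl

  module _ {n} (pivot : Fin n → Bool) (a : X) (W : Fin n → Fin n → X) {A B : Matrix n}
           (W-pivot : ∀ k j → pivot k ≡ false → W k j ≈ 0#)
           (B-pivot : ∀ i j → pivot j ≡ true → B i j ≈ A i j)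
           (B-other : ∀ i j → pivot j ≡ false → B i j ≈ a * A i j + ∑[ k < n ] (W k j * A i k)) where

    private
      overwrite : List (Fin n) → Matrix n
      overwrite [] = A
      overwrite (j ∷ js) = setColumn (overwrite js) j (column B j)

      overwrite-fresh : ∀ js {k} → All (k ≢_) js → ∀ i → overwrite js i k ≈ A i k
      overwrite-fresh [] [] i = refl
      overwrite-fresh (j ∷ js) (k≢j ∷ k∉js) i = trans (setColumn-≢ _ _ i k≢j) (overwrite-fresh js k∉js i)

      overwrite-pivot : ∀ js {k} → pivot k ≡ true → ∀ i → overwrite js i k ≈ A i k
      overwrite-pivot [] _ i = refl
      overwrite-pivot (j ∷ js) {k} pk i with k ≟ j
      ... | yes ≡.refl = B-pivot i k pk
      ... | no _ = overwrite-pivot js pk i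

      overwrite-∈ : ∀ js {k} → k ∈ js → ∀ i → overwrite js i k ≈ B i k
      overwrite-∈ (j ∷ js) {k} k∈ i with k ≟ j
      ... | yes ≡.refl = refl
      ... | no k≢j = overwrite-∈ js (tail k≢j k∈) i
        where tail : k ≢ j → k ∈ j ∷ js → k ∈ js
              tail k≢j (here k≡j) = ⊥-elim (k≢j k≡j)
              tail _ (there k∈js) = k∈js

      combination-overwrite : ∀ js j i → ∑[ k < n ] (W k j * A i k) ≈ ∑[ k < n ] (W k j * overwrite js i k)
      combination-overwrite js j i = sum-cong-≋ {x = λ k → W k j * A i k} λ k → byPivot k (pivot k) ≡.refl
        where
        byPivot : ∀ k b → pivot k ≡ b → W k j * A i k ≈ W k j * overwrite js i k
        byPivot k true pk = *-congˡ (sym (overwrite-pivot js pk i))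
        byPivot k false pk = trans (*-congʳ (W-pivot k j pk)) (trans (zeroˡ _) (sym (trans (*-congʳ (W-pivot k j pk)) (zeroˡ _))))

      Det-overwrite : ∀ js → Unique js → ∃[ t ] Det (overwrite js) ≈ a ^ t * Det A
      Det-overwrite [] [] = 0 , sym (*-identityˡ _)
      Det-overwrite (j ∷ js) (j∉js ∷ unique) with t , eq ← Det-overwrite js unique = byPivot (pivot j) ≡.refl
        where
        M = overwrite js
        Mj≈Aj : ∀ i → M i j ≈ A i j
        Mj≈Aj = overwrite-fresh js j∉js
        byPivot : ∀ b → pivot j ≡ b → ∃[ t ] Det (setColumn M j (column B j)) ≈ a ^ t * Det A
        byPivot true pj = t , trans (Det-cong (λ i k → trans (setColumn-cong M j (λ i → trans (B-pivot i j pj) (sym (Mj≈Aj i))) i k)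
                                                              (setColumn-self M j i k))) eq
        byPivot false pj = suc t , (begin
          Det (setColumn M j (column B j))
            ≈⟨ Det-cong (setColumn-cong M j λ i → trans (B-other i j pj)
                 (+-cong (*-congˡ (sym (Mj≈Aj i))) (combination-overwrite js j i))) ⟩
          Det (setColumn M j (λ i → a * M i j + ∑[ k < n ] (W k j * M i k)))  ≈⟨ Det-addColumns M j a (λ k → W k j) ⟩
          (a + W j j) * Det M            ≈⟨ *-congʳ (trans (+-congˡ (W-pivot j j pj)) (+-identityʳ a)) ⟩
          a * Det M                      ≈⟨ *-congˡ eq ⟩
          a * (a ^ t * Det A)            ≈⟨ *-assoc a _ _ ⟨
          a ^ suc t * Det A              ∎)

    Det-columnOperations : ∃[ t ] Det B ≈ a ^ t * Det A
    Det-columnOperations with t , eq ← Det-overwrite (allFin n) (Uniqueₚ.allFin⁺ n) =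
      t , trans (Det-cong (λ i k → sym (overwrite-∈ (allFin n) (∈-allFin k) i))) eq

  sumSubsets : ∀ k → (Subset k → X) → X
  sumSubsets zero g = g []
  sumSubsets (suc k) g = sumSubsets k (λ s → g (inside ∷ s)) + sumSubsets k (λ s → g (outside ∷ s))

  sumSubsets-cong : ∀ k {f g : Subset k → X} → (∀ s → f s ≈ g s) → sumSubsets k f ≈ sumSubsets k g
  sumSubsets-cong zero f≈g = f≈g []
  sumSubsets-cong (suc k) f≈g =
    +-cong (sumSubsets-cong k (λ s → f≈g (inside ∷ s))) (sumSubsets-cong k (λ s → f≈g (outside ∷ s)))

  *-distribˡ-sumSubsets : ∀ k a (f : Subset k → X) → a * sumSubsets k f ≈ sumSubsets k (λ s → a * f s)
  *-distribˡ-sumSubsets zero a f = refl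
  *-distribˡ-sumSubsets (suc k) a f =
    trans (distribˡ _ _ _) (+-cong (*-distribˡ-sumSubsets k a _) (*-distribˡ-sumSubsets k a _))

  Columns : ℕ → ℕ → Set c
  Columns k n = Fin k → Fin n → X

  choose : ∀ {k n} → Subset k → Columns k n → Columns k n → Columns k n
  choose s U V t = if lookup s t then U t else V t

  _◃_ : ∀ {k n} → (Fin n → X) → Columns k n → Columns (suc k) n
  (u ◃ C) zero = u
  (u ◃ C) (suc t) = C t

  record Multilinear {k n} (F : Columns k n → X) : Set (c ⊔ ℓ) where
    field
      F-cong : ∀ (C C′ : Columns k n) → (∀ t i → C t i ≈ C′ t i) → F C ≈ F C′
      F-linear : ∀ t a b (C C₁ C₂ : Columns k n) →
                 (∀ t′ → t′ ≢ t → ∀ i → C t′ i ≈ C₁ t′ i) →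
                 (∀ t′ → t′ ≢ t → ∀ i → C t′ i ≈ C₂ t′ i) →
                 (∀ i → C t i ≈ a * C₁ t i + b * C₂ t i) → F C ≈ a * F C₁ + b * F C₂

  Multilinear-fixFirst : ∀ {k n} {F : Columns (suc k) n → X} → Multilinear F → ∀ u →
                         Multilinear (λ C → F (u ◃ C))
  Multilinear-fixFirst ml u = record
    { F-cong = λ C C′ C≈C′ → F-cong (u ◃ C) (u ◃ C′) λ { zero i → refl ; (suc t) i → C≈C′ t i }
    ; F-linear = λ t a b C C₁ C₂ C~C₁ C~C₂ Ct → F-linear (suc t) a b (u ◃ C) (u ◃ C₁) (u ◃ C₂)
        (λ { zero _ i → refl ; (suc t′) t′≢t i → C~C₁ t′ (t′≢t ∘ ≡.cong suc) i })
        (λ { zero _ i → refl ; (suc t′) t′≢t i → C~C₂ t′ (t′≢t ∘ ≡.cong suc) i })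
        Ct
    }
    where open Multilinear ml

  Multilinear-expand : ∀ {k n} {F : Columns k n → X} → Multilinear F → ∀ α β (U V : Columns k n) →
    F (λ t i → α * U t i + β * V t i) ≈ sumSubsets k (λ s → α ^ ∣ s ∣ * (β ^ ∣ ∁ s ∣ * F (choose s U V)))
  Multilinear-expand {zero} ml α β U V =
    trans (F-cong _ _ λ ()) (sym (trans (*-identityˡ _) (*-identityˡ _)))
    where open Multilinear ml
  Multilinear-expand {suc k} {F = F} ml α β U V = begin
    F C
      ≈⟨ F-linear zero α β C (U zero ◃ (C ∘ suc)) (V zero ◃ (C ∘ suc)) tail≈ tail≈ (λ i → refl) ⟩
    α * F (U zero ◃ (C ∘ suc)) + β * F (V zero ◃ (C ∘ suc))
      ≈⟨ +-cong (*-congˡ (Multilinear-expand (Multilinear-fixFirst ml (U zero)) α β (U ∘ suc) (V ∘ suc)))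
                (*-congˡ (Multilinear-expand (Multilinear-fixFirst ml (V zero)) α β (U ∘ suc) (V ∘ suc))) ⟩
    α * sumSubsets k (λ s → α ^ ∣ s ∣ * (β ^ ∣ ∁ s ∣ * F (U zero ◃ choose s (U ∘ suc) (V ∘ suc))))
      + β * sumSubsets k (λ s → α ^ ∣ s ∣ * (β ^ ∣ ∁ s ∣ * F (V zero ◃ choose s (U ∘ suc) (V ∘ suc))))
      ≈⟨ +-cong (trans (*-distribˡ-sumSubsets k α _) (sumSubsets-cong k λ s →
                   trans (sym (*-assoc _ _ _)) (*-congˡ (*-congˡ (F-cong _ _ (prepend-choose inside s))))))
                (trans (*-distribˡ-sumSubsets k β _) (sumSubsets-cong k λ s →
                   trans (solve 4 (λ b x y z → b :* (x :* (y :* z)) := x :* ((b :* y) :* z)) refl β _ _ _)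
                         (*-congˡ (*-congˡ (F-cong _ _ (prepend-choose outside s)))))) ⟩
    sumSubsets (suc k) (λ s → α ^ ∣ s ∣ * (β ^ ∣ ∁ s ∣ * F (choose s U V))) ∎
    where
    open Multilinear ml
    C : Columns (suc k) _
    C t i = α * U t i + β * V t i
    tail≈ : ∀ {u} t → t ≢ zero → ∀ i → C t i ≈ (u ◃ (C ∘ suc)) t i
    tail≈ zero t≢0 = ⊥-elim (t≢0 ≡.refl)
    tail≈ (suc t) _ i = refl
    prepend-choose : ∀ b s t i →
      ((if b then U zero else V zero) ◃ choose s (U ∘ suc) (V ∘ suc)) t i ≈ choose (b ∷ s) U V t i
    prepend-choose b s zero i = refl
    prepend-choose b s (suc t) i = refl

  Det-ofColumns : ∀ {n} → Columns n n → X
  Det-ofColumns C = Det (λ i j → C j i)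

  Det-multilinear : ∀ {n} → Multilinear (Det-ofColumns {n})
  Det-multilinear = record
    { F-cong = λ C C′ C≈C′ → Det-cong λ i j → C≈C′ j i
    ; F-linear = λ t a b C C₁ C₂ C~C₁ C~C₂ Ct →
        Det-linear t a b (λ i k k≢t → C~C₁ k k≢t i) (λ i k k≢t → C~C₂ k k≢t i) Ct
    }

module Polynomial where

  open import Algebra.Bundles using (CommutativeRing)
  open import Data.Nat using (zero; suc)
  open import Data.Integer using (+_; -_; _+_; _*_)
  import Data.Integer.Properties as ℤₚ
  open import Algebra.Properties.CommutativeSemigroup ℤₚ.+-commutativeSemigroup using (x∙yz≈y∙xz; interchange)
  open import Data.List using ([]; _∷_)
  open import Data.Product using (_,_)
  open import Level using (0ℓ)
  open import Relation.Binary.PropositionalEquality as ≡ using (_≡_; refl; sym; trans; cong; cong₂)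

  open ≡.≡-Reasoning

  infix 4 _≈ₚ_
  record _≈ₚ_ (p q : Poly) : Set where
    constructor coeffwise
    field coeff-≡ : ∀ k → coeff p k ≡ coeff q k
  open _≈ₚ_ public

  ≈ₚ-refl : ∀ {p} → p ≈ₚ p
  ≈ₚ-refl = coeffwise λ _ → refl

  ≈ₚ-sym : ∀ {p q} → p ≈ₚ q → q ≈ₚ p
  ≈ₚ-sym p≈q = coeffwise λ k → sym (coeff-≡ p≈q k)

  ≈ₚ-trans : ∀ {p q r} → p ≈ₚ q → q ≈ₚ r → p ≈ₚ r
  ≈ₚ-trans p≈q q≈r = coeffwise λ k → trans (coeff-≡ p≈q k) (coeff-≡ q≈r k)

  coeff-[] : ∀ k → coeff [] k ≡ + 0
  coeff-[] zero = refl
  coeff-[] (suc k) = refl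

  coeff-+p : ∀ p q k → coeff (p +p q) k ≡ coeff p k + coeff q k
  coeff-+p [] q k = trans (sym (ℤₚ.+-identityˡ _)) (cong (_+ coeff q k) (sym (coeff-[] k)))
  coeff-+p (a ∷ p) [] k = trans (sym (ℤₚ.+-identityʳ _)) (cong (_+_ (coeff (a ∷ p) k)) (sym (coeff-[] k)))
  coeff-+p (a ∷ p) (b ∷ q) zero = refl
  coeff-+p (a ∷ p) (b ∷ q) (suc k) = coeff-+p p q k

  coeff-scale : ∀ a p k → coeff (scale a p) k ≡ a * coeff p k
  coeff-scale a [] k = trans (coeff-[] k) (trans (sym (ℤₚ.*-zeroʳ a)) (cong (a *_) (sym (coeff-[] k))))
  coeff-scale a (b ∷ p) zero = refl
  coeff-scale a (b ∷ p) (suc k) = coeff-scale a p k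

  coeff-*p : ∀ a p q k → coeff ((a ∷ p) *p q) k ≡ a * coeff q k + coeff (+ 0 ∷ (p *p q)) k
  coeff-*p a p q k = trans (coeff-+p (scale a q) _ k) (cong (_+ _) (coeff-scale a q k))

  coeff-*p-zero : ∀ a p q → coeff ((a ∷ p) *p q) zero ≡ a * coeff q zero
  coeff-*p-zero a p q = trans (coeff-*p a p q zero) (ℤₚ.+-identityʳ _)

  coeff-*p-suc : ∀ a p q k → coeff ((a ∷ p) *p q) (suc k) ≡ a * coeff q (suc k) + coeff (p *p q) k
  coeff-*p-suc a p q k = coeff-*p a p q (suc k)

  +p-cong : ∀ {p p′ q q′} → p ≈ₚ p′ → q ≈ₚ q′ → p +p q ≈ₚ p′ +p q′
  +p-cong {p} {p′} {q} {q′} p≈p′ q≈q′ = coeffwise λ k → begin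
    coeff (p +p q) k          ≡⟨ coeff-+p p q k ⟩
    coeff p k + coeff q k     ≡⟨ cong₂ _+_ (coeff-≡ p≈p′ k) (coeff-≡ q≈q′ k) ⟩
    coeff p′ k + coeff q′ k   ≡⟨ coeff-+p p′ q′ k ⟨
    coeff (p′ +p q′) k        ∎

  scale-cong : ∀ a {p q} → p ≈ₚ q → scale a p ≈ₚ scale a q
  scale-cong a {p} {q} p≈q = coeffwise λ k → begin
    coeff (scale a p) k   ≡⟨ coeff-scale a p k ⟩
    a * coeff p k         ≡⟨ cong (a *_) (coeff-≡ p≈q k) ⟩
    a * coeff q k         ≡⟨ coeff-scale a q k ⟨
    coeff (scale a q) k   ∎

  ∷-cong : ∀ {a b p q} → a ≡ b → p ≈ₚ q → a ∷ p ≈ₚ b ∷ q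
  ∷-cong a≡b p≈q = coeffwise λ { zero → a≡b ; (suc k) → coeff-≡ p≈q k }

  *p-congʳ : ∀ p {q q′} → q ≈ₚ q′ → p *p q ≈ₚ p *p q′
  *p-congʳ [] q≈q′ = ≈ₚ-refl
  *p-congʳ (a ∷ p) q≈q′ = +p-cong (scale-cong a q≈q′) (∷-cong refl (*p-congʳ p q≈q′))

  +p-comm : ∀ p q → p +p q ≈ₚ q +p p
  +p-comm p q = coeffwise λ k → begin
    coeff (p +p q) k         ≡⟨ coeff-+p p q k ⟩
    coeff p k + coeff q k    ≡⟨ ℤₚ.+-comm (coeff p k) _ ⟩
    coeff q k + coeff p k    ≡⟨ coeff-+p q p k ⟨
    coeff (q +p p) k         ∎

  +p-assoc : ∀ p q r → (p +p q) +p r ≈ₚ p +p (q +p r)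
  +p-assoc p q r = coeffwise λ k → begin
    coeff ((p +p q) +p r) k                 ≡⟨ trans (coeff-+p (p +p q) r k) (cong (_+ _) (coeff-+p p q k)) ⟩
    (coeff p k + coeff q k) + coeff r k     ≡⟨ ℤₚ.+-assoc (coeff p k) _ _ ⟩
    coeff p k + (coeff q k + coeff r k)     ≡⟨ trans (coeff-+p p (q +p r) k) (cong (_+_ (coeff p k)) (coeff-+p q r k)) ⟨
    coeff (p +p (q +p r)) k                 ∎

  +p-identityʳ : ∀ p → p +p [] ≈ₚ p
  +p-identityʳ p = coeffwise λ k →
    trans (coeff-+p p [] k) (trans (cong (_+_ (coeff p k)) (coeff-[] k)) (ℤₚ.+-identityʳ _))

  negₚ : Poly → Poly
  negₚ = scale (- + 1)

  negₚ-inverseˡ : ∀ p → negₚ p +p p ≈ₚ []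
  negₚ-inverseˡ p = coeffwise λ k → begin
    coeff (negₚ p +p p) k            ≡⟨ trans (coeff-+p (negₚ p) p k) (cong (_+ coeff p k) (coeff-scale (- + 1) p k)) ⟩
    - + 1 * coeff p k + coeff p k    ≡⟨ trans (cong (_+ coeff p k) (ℤₚ.-1*i≡-i (coeff p k))) (ℤₚ.+-inverseˡ (coeff p k)) ⟩
    + 0                              ≡⟨ coeff-[] k ⟨
    coeff [] k                       ∎

  *p-zeroʳ : ∀ p → p *p [] ≈ₚ []
  *p-zeroʳ [] = ≈ₚ-refl
  *p-zeroʳ (a ∷ p) = coeffwise λ { zero → refl ; (suc k) → trans (coeff-≡ (*p-zeroʳ p) k) (coeff-[] k) }

  *p-consʳ : ∀ p b q → p *p (b ∷ q) ≈ₚ scale b p +p (+ 0 ∷ (p *p q))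
  *p-consʳ [] b q = coeffwise λ { zero → refl ; (suc k) → sym (coeff-[] k) }
  *p-consʳ (a ∷ p) b q = coeffwise λ
    { zero → trans (coeff-*p-zero a p (b ∷ q)) (sym (trans (coeff-+p (scale b (a ∷ p)) (+ 0 ∷ ((a ∷ p) *p q)) zero)
                                                      (trans (ℤₚ.+-identityʳ (b * a)) (ℤₚ.*-comm b a))))
    ; (suc k) → begin
      coeff ((a ∷ p) *p (b ∷ q)) (suc k)                    ≡⟨ coeff-*p-suc a p (b ∷ q) k ⟩
      a * coeff q k + coeff (p *p (b ∷ q)) k                ≡⟨ cong (_+_ (a * coeff q k)) (coeff-≡ (*p-consʳ p b q) k) ⟩
      a * coeff q k + coeff (scale b p +p r) k              ≡⟨ cong (_+_ (a * coeff q k)) (trans (coeff-+p (scale b p) r k)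
                                                                 (cong (_+ coeff r k) (coeff-scale b p k))) ⟩
      a * coeff q k + (b * coeff p k + coeff r k)           ≡⟨ x∙yz≈y∙xz (a * coeff q k) (b * coeff p k) (coeff r k) ⟩
      b * coeff p k + (a * coeff q k + coeff r k)           ≡⟨ cong (_+_ (b * coeff p k)) (coeff-*p a p q k) ⟨
      b * coeff p k + coeff ((a ∷ p) *p q) k                ≡⟨ cong (_+ coeff ((a ∷ p) *p q) k) (coeff-scale b p k) ⟨
      coeff (scale b p) k + coeff ((a ∷ p) *p q) k          ≡⟨ coeff-+p (scale b (a ∷ p)) (+ 0 ∷ ((a ∷ p) *p q)) (suc k) ⟨
      coeff (scale b (a ∷ p) +p (+ 0 ∷ ((a ∷ p) *p q))) (suc k) ∎
    }
    where r = + 0 ∷ (p *p q)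

  *p-comm : ∀ p q → p *p q ≈ₚ q *p p
  *p-comm [] q = ≈ₚ-sym (*p-zeroʳ q)
  *p-comm (a ∷ p) q = ≈ₚ-trans (+p-cong ≈ₚ-refl (∷-cong refl (*p-comm p q))) (≈ₚ-sym (*p-consʳ q a p))

  *p-congˡ : ∀ {p p′} q → p ≈ₚ p′ → p *p q ≈ₚ p′ *p q
  *p-congˡ {p} {p′} q p≈p′ = ≈ₚ-trans (*p-comm p q) (≈ₚ-trans (*p-congʳ q p≈p′) (*p-comm q p′))

  *p-distribˡ : ∀ p q r → p *p (q +p r) ≈ₚ (p *p q) +p (p *p r)
  *p-distribˡ [] q r = ≈ₚ-refl
  *p-distribˡ (a ∷ p) q r = coeffwise λ k → begin
    coeff ((a ∷ p) *p (q +p r)) k                               ≡⟨ coeff-*p a p (q +p r) k ⟩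
    a * coeff (q +p r) k + coeff (+ 0 ∷ (p *p (q +p r))) k
      ≡⟨ cong₂ _+_ (trans (cong (a *_) (coeff-+p q r k)) (ℤₚ.*-distribˡ-+ a (coeff q k) (coeff r k)))
                   (coeff-≡ (∷-cong refl (*p-distribˡ p q r)) k) ⟩
    (a * coeff q k + a * coeff r k) + coeff (+ 0 ∷ ((p *p q) +p (p *p r))) k
      ≡⟨ cong (_+_ (a * coeff q k + a * coeff r k)) (coeff-+p (+ 0 ∷ (p *p q)) (+ 0 ∷ (p *p r)) k) ⟩
    (a * coeff q k + a * coeff r k) + (coeff (+ 0 ∷ (p *p q)) k + coeff (+ 0 ∷ (p *p r)) k)
      ≡⟨ interchange (a * coeff q k) (a * coeff r k) (coeff (+ 0 ∷ (p *p q)) k) (coeff (+ 0 ∷ (p *p r)) k) ⟩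
    (a * coeff q k + coeff (+ 0 ∷ (p *p q)) k) + (a * coeff r k + coeff (+ 0 ∷ (p *p r)) k)
      ≡⟨ cong₂ _+_ (coeff-*p a p q k) (coeff-*p a p r k) ⟨
    coeff ((a ∷ p) *p q) k + coeff ((a ∷ p) *p r) k             ≡⟨ coeff-+p ((a ∷ p) *p q) ((a ∷ p) *p r) k ⟨
    coeff (((a ∷ p) *p q) +p ((a ∷ p) *p r)) k                      ∎

  *p-distribʳ : ∀ p q r → (q +p r) *p p ≈ₚ (q *p p) +p (r *p p)
  *p-distribʳ p q r = ≈ₚ-trans (*p-comm (q +p r) p)
    (≈ₚ-trans (*p-distribˡ p q r) (+p-cong (*p-comm p q) (*p-comm p r)))

  scale-*p : ∀ a q r → scale a q *p r ≈ₚ scale a (q *p r)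
  scale-*p a [] r = ≈ₚ-refl
  scale-*p a (b ∷ q) r = coeffwise λ
    { zero → begin
      coeff ((a * b ∷ scale a q) *p r) zero   ≡⟨ coeff-*p-zero (a * b) (scale a q) r ⟩
      a * b * coeff r zero                    ≡⟨ ℤₚ.*-assoc a b (coeff r zero) ⟩
      a * (b * coeff r zero)                  ≡⟨ cong (a *_) (coeff-*p-zero b q r) ⟨
      a * coeff ((b ∷ q) *p r) zero           ≡⟨ coeff-scale a ((b ∷ q) *p r) zero ⟨
      coeff (scale a ((b ∷ q) *p r)) zero     ∎
    ; (suc k) → begin
      coeff ((a * b ∷ scale a q) *p r) (suc k)        ≡⟨ coeff-*p-suc (a * b) (scale a q) r k ⟩
      a * b * coeff r (suc k) + coeff (scale a q *p r) k
        ≡⟨ cong₂ _+_ (ℤₚ.*-assoc a b (coeff r (suc k))) (trans (coeff-≡ (scale-*p a q r) k) (coeff-scale a (q *p r) k)) ⟩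
      a * (b * coeff r (suc k)) + a * coeff (q *p r) k ≡⟨ ℤₚ.*-distribˡ-+ a (b * coeff r (suc k)) (coeff (q *p r) k) ⟨
      a * (b * coeff r (suc k) + coeff (q *p r) k)     ≡⟨ cong (a *_) (coeff-*p-suc b q r k) ⟨
      a * coeff ((b ∷ q) *p r) (suc k)                 ≡⟨ coeff-scale a ((b ∷ q) *p r) (suc k) ⟨
      coeff (scale a ((b ∷ q) *p r)) (suc k)           ∎
    }

  shift-*p : ∀ p r → (+ 0 ∷ p) *p r ≈ₚ + 0 ∷ (p *p r)
  shift-*p p r = coeffwise λ
    { zero → coeff-*p-zero (+ 0) p r
    ; (suc k) → trans (coeff-*p-suc (+ 0) p r k) (ℤₚ.+-identityˡ (coeff (p *p r) k))
    }

  *p-assoc : ∀ p q r → (p *p q) *p r ≈ₚ p *p (q *p r)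
  *p-assoc [] q r = ≈ₚ-refl
  *p-assoc (a ∷ p) q r = ≈ₚ-trans (*p-distribʳ r (scale a q) (+ 0 ∷ (p *p q)))
    (+p-cong (scale-*p a q r) (≈ₚ-trans (shift-*p (p *p q) r) (∷-cong refl (*p-assoc p q r))))

  oneₚ : Poly
  oneₚ = + 1 ∷ []

  coeff-[0] : ∀ k → coeff (+ 0 ∷ []) k ≡ + 0
  coeff-[0] zero = refl
  coeff-[0] (suc k) = refl

  *p-identityˡ : ∀ p → oneₚ *p p ≈ₚ p
  *p-identityˡ p = coeffwise λ k → begin
    coeff (scale (+ 1) p +p (+ 0 ∷ [])) k          ≡⟨ coeff-+p (scale (+ 1) p) (+ 0 ∷ []) k ⟩
    coeff (scale (+ 1) p) k + coeff (+ 0 ∷ []) k   ≡⟨ cong (_+ coeff (+ 0 ∷ []) k) (coeff-scale (+ 1) p k) ⟩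
    + 1 * coeff p k + coeff (+ 0 ∷ []) k           ≡⟨ cong₂ _+_ (ℤₚ.*-identityˡ (coeff p k)) (coeff-[0] k) ⟩
    coeff p k + + 0                                ≡⟨ ℤₚ.+-identityʳ (coeff p k) ⟩
    coeff p k                                      ∎

  ℤ[x] : CommutativeRing 0ℓ 0ℓ
  ℤ[x] = record
    { Carrier = Poly
    ; _≈_ = _≈ₚ_
    ; _+_ = _+p_
    ; _*_ = _*p_
    ; -_ = negₚ
    ; 0# = []
    ; 1# = oneₚ
    ; isCommutativeRing = record
      { isRing = record
        { +-isAbelianGroup = record
          { isGroup = record
            { isMonoid = record
              { isSemigroup = record
                { isMagma = record
                  { isEquivalence = record { refl = ≈ₚ-refl ; sym = ≈ₚ-sym ; trans = ≈ₚ-trans }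
                  ; ∙-cong = +p-cong
                  }
                ; assoc = +p-assoc
                }
              ; identity = (λ p → ≈ₚ-refl) , +p-identityʳ
              }
            ; inverse = negₚ-inverseˡ , λ p → ≈ₚ-trans (+p-comm p (negₚ p)) (negₚ-inverseˡ p)
            ; ⁻¹-cong = scale-cong (- + 1)
            }
          ; comm = +p-comm
          }
        ; *-cong = λ {p} {p′} {q} {q′} p≈p′ q≈q′ → ≈ₚ-trans (*p-congˡ q p≈p′) (*p-congʳ p′ q≈q′)
        ; *-assoc = *p-assoc
        ; *-identity = *p-identityˡ , λ p → ≈ₚ-trans (*p-comm p oneₚ) (*p-identityˡ p)
        ; distrib = *p-distribˡ , *p-distribʳ
        }
      ; *-comm = *p-comm
      }
    }

module CharacteristicPolynomial where

  open import Algebra.Bundles using (CommutativeRing)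
  open import Data.Nat using (ℕ; zero; suc; _∸_)
  open import Data.Integer using (ℤ; +_; -_; -1ℤ; _+_; _*_; _^_)
  import Data.Integer.Properties as ℤₚ
  open import Data.Fin using (Fin; zero; suc; toℕ; _≟_)
  open import Data.Fin.Subset using (Subset; inside; outside; ∣_∣; ∁)
  import Data.Fin.Subset.Properties as Subsetₚ
  open import Data.Vec using ([]; _∷_; lookup)
  open import Data.Bool using (true; false; if_then_else_)
  open import Data.List using ([]; _∷_)
  open import Data.Product using (∃-syntax; _,_; proj₁)
  open import Function using (_∘_)
  open import Data.Empty using (⊥-elim)
  open import Relation.Nullary using (yes; no)
  open import Relation.Binary.PropositionalEquality as ≡ using (_≡_; _≢_; refl; sym; trans; cong; cong₂)

  open Polynomial
  module P = Determinant ℤ[x]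
  module ℤ[x] = CommutativeRing ℤ[x]
  module Z = Determinant ℤₚ.+-*-commutativeRing

  const : ℤ → Poly
  const a = a ∷ []

  const-* : ∀ a b → const a *p const b ≈ₚ const (a * b)
  const-* a b = coeffwise λ { zero → ℤₚ.+-identityʳ (a * b) ; (suc k) → refl }

  const-*p : ∀ a p → const a *p p ≈ₚ scale a p
  const-*p a p = coeffwise λ k → begin
    coeff (scale a p +p (+ 0 ∷ [])) k            ≡⟨ coeff-+p (scale a p) (+ 0 ∷ []) k ⟩
    coeff (scale a p) k + coeff (+ 0 ∷ []) k     ≡⟨ cong (_+_ (coeff (scale a p) k)) (coeff-[0] k) ⟩
    coeff (scale a p) k + + 0                    ≡⟨ ℤₚ.+-identityʳ _ ⟩
    coeff (scale a p) k                          ∎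
    where open ≡.≡-Reasoning

  const-^ : ∀ a n → const a P.^ n ≈ₚ const (a ^ n)
  const-^ a zero = ≈ₚ-refl
  const-^ a (suc n) = ≈ₚ-trans (*p-congʳ (const a) (const-^ a n)) (const-* a (a ^ n))

  const-sign : ∀ k → P.sign k ≈ₚ const (Z.sign k)
  const-sign zero = ≈ₚ-refl
  const-sign (suc k) = ≈ₚ-trans (scale-cong -1ℤ (const-sign k))
                                (∷-cong (ℤₚ.-1*i≡-i (Z.sign k)) ≈ₚ-refl)

  const-sum : ∀ {m} (f : Fin m → ℤ) → P.sum (const ∘ f) ≈ₚ const (Z.sum f)
  const-sum {zero} f = coeffwise λ { zero → refl ; (suc k) → refl }
  const-sum {suc m} f = ℤ[x].+-congˡ (const-sum (f ∘ suc))

  Det-const : ∀ {m} (A : Z.Matrix m) → P.Det (λ i j → const (A i j)) ≈ₚ const (Z.Det A)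
  Det-const {zero} A = ≈ₚ-refl
  Det-const {suc m} A = ≈ₚ-trans
    (P.sum-cong-≋ {x = P.expansionTerm (λ i j → const (A i j))} {const ∘ Z.expansionTerm A} λ j →
      ≈ₚ-trans (ℤ[x].*-cong (const-sign (toℕ j)) (≈ₚ-trans (*p-congʳ (const (A zero j)) (Det-const (Z.minor j A)))
                                                         (const-* (A zero j) _)))
               (const-* (Z.sign (toℕ j)) _))
    (const-sum (Z.expansionTerm A))

  sgn≡sign : ∀ k → sgn k ≡ Z.sign k
  sgn≡sign zero = refl
  sgn≡sign (suc k) = cong -_ (sgn≡sign k)

  sumFin≈sum : ∀ m (f g : Fin m → Poly) → (∀ j → f j ≈ₚ g j) → sumFin m f ≈ₚ P.sum g
  sumFin≈sum zero f g f≈g = ≈ₚ-refl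
  sumFin≈sum (suc m) f g f≈g = +p-cong (f≈g zero) (sumFin≈sum m (f ∘ suc) (g ∘ suc) (f≈g ∘ suc))

  det≈Det : ∀ m A → det m A ≈ₚ P.Det A
  det≈Det zero A = ≈ₚ-refl
  det≈Det (suc m) A = sumFin≈sum (suc m) _ (P.expansionTerm A) termwise
    where
    termwise : ∀ j → scale (sgn (toℕ j)) (A zero j *p det m (P.minor j A)) ≈ₚ P.expansionTerm A j
    termwise j = ≈ₚ-trans (scale-cong (sgn (toℕ j)) (*p-congʳ (A zero j) (det≈Det m (P.minor j A))))
                          (≈ₚ-sym (≈ₚ-trans (*p-congˡ t sign≈sgn) (const-*p (sgn (toℕ j)) t)))
      where
      t = A zero j *p P.Det (P.minor j A)
      sign≈sgn : P.sign (toℕ j) ≈ₚ const (sgn (toℕ j))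
      sign≈sgn = ≈ₚ-trans (const-sign (toℕ j)) (∷-cong (sym (sgn≡sign (toℕ j))) ≈ₚ-refl)

  -- The matrix xI - M of charPoly is local to its where-block; unification recovers it.
  private
    charMatrix′ : ∀ m M → ∃[ A ] det m A ≡ charPoly m M
    charMatrix′ m M = _ , refl

  charMatrix : ∀ m → (Fin m → Fin m → ℤ) → P.Matrix m
  charMatrix m M = proj₁ (charMatrix′ m M)

  xₚ : Poly
  xₚ = + 0 ∷ + 1 ∷ []

  private
    constantCoeff : ∀ c → - c ≡ + 0 + (-1ℤ * c + + 0)
    constantCoeff c = sym (trans (ℤₚ.+-identityˡ _) (trans (ℤₚ.+-identityʳ _) (ℤₚ.-1*i≡-i c)))

  charMatrix-entry : ∀ m M (i j : Fin m) →
                     charMatrix m M i j ≈ₚ (xₚ *p const (Z.δ i j)) +p (const -1ℤ *p const (M i j))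
  charMatrix-entry m M i j with i ≟ j
  ... | yes _ = coeffwise λ { zero → constantCoeff (M i j) ; (suc zero) → refl ; (suc (suc k)) → refl }
  ... | no _ = coeffwise λ { zero → constantCoeff (M i j) ; (suc zero) → refl ; (suc (suc k)) → refl }

  withUnitColumns : ∀ {m} → Subset m → Z.Matrix m → Z.Matrix m
  withUnitColumns s M i j = if lookup s j then Z.δ i j else M i j

  charPoly-expansion : ∀ m M → charPoly m M ≈ₚ
    P.sumSubsets m (λ s → (xₚ P.^ ∣ s ∣) *p ((const -1ℤ P.^ ∣ ∁ s ∣) *p const (Z.Det (withUnitColumns s M))))
  charPoly-expansion m M = begin
    det m (charMatrix m M)                         ≈⟨ det≈Det m (charMatrix m M) ⟩
    P.Det (charMatrix m M)                         ≈⟨ P.Det-cong (charMatrix-entry m M) ⟩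
    P.Det-ofColumns (λ t i → (xₚ *p U t i) +p (const -1ℤ *p V t i))
      ≈⟨ P.Multilinear-expand P.Det-multilinear xₚ (const -1ℤ) U V ⟩
    P.sumSubsets m (λ s → (xₚ P.^ ∣ s ∣) *p ((const -1ℤ P.^ ∣ ∁ s ∣) *p P.Det-ofColumns (P.choose s U V)))
      ≈⟨ P.sumSubsets-cong m (λ s → *p-congʳ (xₚ P.^ ∣ s ∣) (*p-congʳ (const -1ℤ P.^ ∣ ∁ s ∣)
                                      (≈ₚ-trans (P.Det-cong (chosen s)) (Det-const (withUnitColumns s M))))) ⟩
    P.sumSubsets m (λ s → (xₚ P.^ ∣ s ∣) *p ((const -1ℤ P.^ ∣ ∁ s ∣) *p const (Z.Det (withUnitColumns s M)))) ∎
    where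
    open import Relation.Binary.Reasoning.Setoid ℤ[x].setoid
    U V : P.Columns m m
    U t i = const (Z.δ i t)
    V t i = const (M i t)
    chosen : ∀ s i j → P.choose s U V j i ≈ₚ const (withUnitColumns s M i j)
    chosen s i j with lookup s j
    ... | true = ≈ₚ-refl
    ... | false = ≈ₚ-refl

  monomialCoeff : ℕ → ℕ → ℤ → ℤ
  monomialCoeff zero zero e = e
  monomialCoeff zero (suc k) e = + 0
  monomialCoeff (suc n) zero e = + 0
  monomialCoeff (suc n) (suc k) e = monomialCoeff n k e

  monomialCoeff-≢ : ∀ {n k} e → n ≢ k → monomialCoeff n k e ≡ + 0
  monomialCoeff-≢ {zero} {zero} e n≢k = ⊥-elim (n≢k refl)
  monomialCoeff-≢ {zero} {suc k} e n≢k = refl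
  monomialCoeff-≢ {suc n} {zero} e n≢k = refl
  monomialCoeff-≢ {suc n} {suc k} e n≢k = monomialCoeff-≢ e (n≢k ∘ cong suc)

  monomialCoeff-≡ : ∀ {n k} e → n ≡ k → monomialCoeff n k e ≡ e
  monomialCoeff-≡ {zero} e refl = refl
  monomialCoeff-≡ {suc n} e refl = monomialCoeff-≡ {n} e refl

  monomialCoeff-* : ∀ n k a e → monomialCoeff n k (a * e) ≡ a * monomialCoeff n k e
  monomialCoeff-* zero zero a e = refl
  monomialCoeff-* zero (suc k) a e = sym (ℤₚ.*-zeroʳ a)
  monomialCoeff-* (suc n) zero a e = sym (ℤₚ.*-zeroʳ a)
  monomialCoeff-* (suc n) (suc k) a e = monomialCoeff-* n k a e

  monomialCoeff-diagonal : ∀ n k (g : ℕ → ℤ) → monomialCoeff n k (g n) ≡ monomialCoeff n k (g k)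
  monomialCoeff-diagonal zero zero g = refl
  monomialCoeff-diagonal zero (suc k) g = refl
  monomialCoeff-diagonal (suc n) zero g = refl
  monomialCoeff-diagonal (suc n) (suc k) g = monomialCoeff-diagonal n k (g ∘ suc)

  coeff-xₚ*p-zero : ∀ q → coeff (xₚ *p q) zero ≡ + 0
  coeff-xₚ*p-zero q = trans (coeff-*p-zero (+ 0) (+ 1 ∷ []) q) (ℤₚ.*-zeroˡ (coeff q zero))

  coeff-xₚ*p-suc : ∀ q k → coeff (xₚ *p q) (suc k) ≡ coeff q k
  coeff-xₚ*p-suc q k = trans (coeff-*p-suc (+ 0) (+ 1 ∷ []) q k)
    (trans (cong (_+ coeff (oneₚ *p q) k) (ℤₚ.*-zeroˡ (coeff q (suc k))))
           (trans (ℤₚ.+-identityˡ _) (coeff-≡ (*p-identityˡ q) k)))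

  coeff-xₚ^ : ∀ n e k → coeff ((xₚ P.^ n) *p const e) k ≡ monomialCoeff n k e
  coeff-xₚ^ zero e zero = coeff-≡ (*p-identityˡ (const e)) zero
  coeff-xₚ^ zero e (suc k) = trans (coeff-≡ (*p-identityˡ (const e)) (suc k)) (coeff-[] k)
  coeff-xₚ^ (suc n) e zero =
    trans (coeff-≡ (*p-assoc xₚ (xₚ P.^ n) (const e)) zero) (coeff-xₚ*p-zero ((xₚ P.^ n) *p const e))
  coeff-xₚ^ (suc n) e (suc k) = trans (coeff-≡ (*p-assoc xₚ (xₚ P.^ n) (const e)) (suc k))
    (trans (coeff-xₚ*p-suc ((xₚ P.^ n) *p const e) k) (coeff-xₚ^ n e k))

  coeff-sumSubsets : ∀ m (g : Subset m → Poly) k → coeff (P.sumSubsets m g) k ≡ Z.sumSubsets m (λ s → coeff (g s) k)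
  coeff-sumSubsets zero g k = refl
  coeff-sumSubsets (suc m) g k = trans (coeff-+p (P.sumSubsets m (g ∘ (inside ∷_))) _ k)
    (cong₂ _+_ (coeff-sumSubsets m (g ∘ (inside ∷_)) k) (coeff-sumSubsets m (g ∘ (outside ∷_)) k))

  coeff-charPoly : ∀ m M k → coeff (charPoly m M) k ≡
    -1ℤ ^ (m ∸ k) * Z.sumSubsets m (λ s → monomialCoeff ∣ s ∣ k (Z.Det (withUnitColumns s M)))
  coeff-charPoly m M k = begin
    coeff (charPoly m M) k                           ≡⟨ coeff-≡ (charPoly-expansion m M) k ⟩
    coeff (P.sumSubsets m term) k                    ≡⟨ coeff-sumSubsets m term k ⟩
    Z.sumSubsets m (λ s → coeff (term s) k)          ≡⟨ Z.sumSubsets-cong m termCoeff ⟩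
    Z.sumSubsets m (λ s → -1ℤ ^ (m ∸ k) * monomialCoeff ∣ s ∣ k (D s))
      ≡⟨ Z.*-distribˡ-sumSubsets m (-1ℤ ^ (m ∸ k)) (λ s → monomialCoeff ∣ s ∣ k (D s)) ⟨
    -1ℤ ^ (m ∸ k) * Z.sumSubsets m (λ s → monomialCoeff ∣ s ∣ k (D s)) ∎
    where
    open ≡.≡-Reasoning
    D : Subset m → ℤ
    D s = Z.Det (withUnitColumns s M)
    term : Subset m → Poly
    term s = (xₚ P.^ ∣ s ∣) *p ((const -1ℤ P.^ ∣ ∁ s ∣) *p const (D s))
    termCoeff : ∀ s → coeff (term s) k ≡ -1ℤ ^ (m ∸ k) * monomialCoeff ∣ s ∣ k (D s)
    termCoeff s = begin
      coeff (term s) k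
        ≡⟨ coeff-≡ (*p-congʳ (xₚ P.^ size) (≈ₚ-trans (*p-congˡ (const (D s)) (const-^ -1ℤ coSize))
                                                    (const-* (-1ℤ ^ coSize) (D s)))) k ⟩
      coeff ((xₚ P.^ size) *p const (-1ℤ ^ coSize * D s)) k  ≡⟨ coeff-xₚ^ size _ k ⟩
      monomialCoeff size k (-1ℤ ^ coSize * D s)
        ≡⟨ cong (λ t → monomialCoeff size k (-1ℤ ^ t * D s)) (Subsetₚ.∣∁p∣≡n∸∣p∣ s) ⟩
      monomialCoeff size k (-1ℤ ^ (m ∸ size) * D s)   ≡⟨ monomialCoeff-diagonal size k (λ t → -1ℤ ^ (m ∸ t) * D s) ⟩
      monomialCoeff size k (-1ℤ ^ (m ∸ k) * D s)      ≡⟨ monomialCoeff-* size k (-1ℤ ^ (m ∸ k)) (D s) ⟩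
      -1ℤ ^ (m ∸ k) * monomialCoeff size k (D s)      ∎
      where
      size = ∣ s ∣
      coSize = ∣ ∁ s ∣

module PositiveDefinite where

  open import Data.Nat using (zero; suc; z≤n; s≤s)
  open import Data.Integer using (ℤ; +_; -_; -1ℤ; _+_; _-_; _*_; _<_; +<+; +[1+_])
  import Data.Integer.Properties as ℤₚ
  open import Data.Integer.Tactic.RingSolver using (solve-∀)
  open import Data.Fin using (Fin; zero; suc)
  open import Data.Bool using (Bool; true; false)
  open import Data.Product using (∃-syntax; _,_; proj₁; proj₂)
  open import Data.Sum using ([_,_]′)
  open import Relation.Binary.PropositionalEquality as ≡ using (_≡_; _≢_; refl; sym; trans; cong; cong₂; subst)

  open Determinant ℤₚ.+-*-commutativeRing
    using (Matrix; Det; minor; sum; sum-syntax; sum-cong-≋; ∑-distrib-+; *-distribˡ-sum; *-distribʳ-sum; sum-zero; sum-single;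
           δ; δ-≡; δ-≢;
           Det-firstRow; Det-columnOperations; _^_)

  *-positive : ∀ {a b} → + 0 < a → + 0 < b → + 0 < a * b
  *-positive {+[1+ _ ]} {+[1+ _ ]} _ _ = +<+ (s≤s z≤n)
  *-positive {+ zero} (+<+ ()) _
  *-positive {+[1+ _ ]} {+ zero} _ (+<+ ())

  positive-cancelˡ : ∀ {a x} → + 0 < a → + 0 < a * x → + 0 < x
  positive-cancelˡ {+ zero} (+<+ ()) _
  positive-cancelˡ {+[1+ n ]} {x} _ 0<ax =
    ℤₚ.*-cancelˡ-<-nonNeg +[1+ n ] (subst (_< +[1+ n ] * x) (sym (ℤₚ.*-zeroʳ +[1+ n ])) 0<ax)

  ^-positive : ∀ {a} t → + 0 < a → + 0 < a ^ t
  ^-positive zero _ = +<+ (s≤s z≤n)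
  ^-positive (suc t) 0<a = *-positive 0<a (^-positive t 0<a)

  ∑∑ : ∀ {m} → (Fin m → Fin m → ℤ) → ℤ
  ∑∑ {m} f = ∑[ i < m ] ∑[ j < m ] f i j

  quadraticForm : ∀ {m} → Matrix m → (Fin m → ℤ) → ℤ
  quadraticForm A v = ∑∑ λ i j → v i * A i j * v j

  Symmetric : ∀ {m} → Matrix m → Set
  Symmetric A = ∀ i j → A i j ≡ A j i

  PositiveDefinite : ∀ {m} → Matrix m → Set
  PositiveDefinite A = ∀ v → ∃[ i ] v i ≢ + 0 → + 0 < quadraticForm A v

  ∑∑-cong : ∀ {m} {f g : Fin m → Fin m → ℤ} → (∀ i j → f i j ≡ g i j) → ∑∑ f ≡ ∑∑ g
  ∑∑-cong {f = f} {g} f≡g = sum-cong-≋ {x = λ i → sum (f i)} λ i → sum-cong-≋ {x = f i} (f≡g i)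

  ∑∑-scale : ∀ {m} a (f : Fin m → Fin m → ℤ) → ∑∑ (λ i j → a * f i j) ≡ a * ∑∑ f
  ∑∑-scale a f = trans (sum-cong-≋ {x = λ i → sum (λ j → a * f i j)} λ i → sym (*-distribˡ-sum a (f i)))
                       (sym (*-distribˡ-sum a (λ i → sum (f i))))

  ∑∑-+ : ∀ {m} (f g : Fin m → Fin m → ℤ) → ∑∑ (λ i j → f i j + g i j) ≡ ∑∑ f + ∑∑ g
  ∑∑-+ f g = trans (sum-cong-≋ {x = λ i → sum (λ j → f i j + g i j)} λ i → ∑-distrib-+ (f i) (g i))
                   (∑-distrib-+ (λ i → sum (f i)) (λ i → sum (g i)))

  ∑∑-product : ∀ {m} (x y : Fin m → ℤ) → ∑∑ (λ i j → x i * y j) ≡ sum x * sum y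
  ∑∑-product x y = trans (sum-cong-≋ {x = λ i → sum (λ j → x i * y j)} λ i → sym (*-distribˡ-sum (x i) y))
                         (sym (*-distribʳ-sum (sum y) x))

  ∑∑-suc : ∀ {m} (f : Fin (suc m) → Fin (suc m) → ℤ) → ∑∑ f ≡
    (f zero zero + sum (λ c → f zero (suc c))) + (sum (λ r → f (suc r) zero) + ∑∑ (λ r c → f (suc r) (suc c)))
  ∑∑-suc f = cong (_+_ (f zero zero + sum (λ c → f zero (suc c))))
                  (∑-distrib-+ (λ r → f (suc r) zero) (λ r → sum (λ c → f (suc r) (suc c))))

  quadraticForm-unit : ∀ {m} (A : Matrix m) j → quadraticForm A (λ i → δ i j) ≡ A j j
  quadraticForm-unit {m} A j = begin
    ∑[ i < m ] ∑[ k < m ] (δ i j * A i k * δ k j)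
      ≡⟨ sum-cong-≋ {x = λ i → ∑[ k < m ] (δ i j * A i k * δ k j)} (λ i →
           sum-single j (λ k → δ i j * A i k * δ k j) λ k k≢j →
           trans (cong (δ i j * A i k *_) (δ-≢ k≢j)) (ℤₚ.*-zeroʳ (δ i j * A i k))) ⟩
    ∑[ i < m ] (δ i j * A i j * δ j j)
      ≡⟨ sum-single j (λ i → δ i j * A i j * δ j j) (λ i i≢j → cong (λ d → d * A i j * δ j j) (δ-≢ i≢j)) ⟩
    δ j j * A j j * δ j j                          ≡⟨ cong₂ (λ d e → d * A j j * e) (δ-≡ j) (δ-≡ j) ⟩
    + 1 * A j j * + 1                              ≡⟨ trans (ℤₚ.*-identityʳ _) (ℤₚ.*-identityˡ _) ⟩
    A j j                                          ∎
    where open ≡.≡-Reasoning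

  module Elimination {m} (A : Matrix (suc m)) (A-sym : Symmetric A) where

    a : ℤ
    a = A zero zero

    eliminated : Matrix (suc m)
    eliminated i zero = A i zero
    eliminated i (suc c) = a * A i (suc c) + (- A zero (suc c)) * A i zero

    schur : Matrix m
    schur = minor zero eliminated

    schur-symmetric : Symmetric schur
    schur-symmetric r c = cong₂ _+_ (cong (a *_) (A-sym (suc r) (suc c))) (begin
      (- A zero (suc c)) * A (suc r) zero  ≡⟨ cong₂ (λ x y → (- x) * y) (A-sym zero (suc c)) (A-sym (suc r) zero) ⟩
      (- A (suc c) zero) * A zero (suc r)  ≡⟨ ℤₚ.neg-distribˡ-* (A (suc c) zero) _ ⟨
      - (A (suc c) zero * A zero (suc r))  ≡⟨ cong -_ (ℤₚ.*-comm (A (suc c) zero) _) ⟩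
      - (A zero (suc r) * A (suc c) zero)  ≡⟨ ℤₚ.neg-distribˡ-* (A zero (suc r)) _ ⟩
      (- A zero (suc r)) * A (suc c) zero  ∎)
      where open ≡.≡-Reasoning

    Det-eliminated : Det eliminated ≡ a * Det schur
    Det-eliminated = Det-firstRow eliminated λ c → cancel a (A zero (suc c))
      where
      cancel : ∀ a x → a * x + (- x) * a ≡ + 0
      cancel = solve-∀

    Det-eliminated-scaled : ∃[ t ] Det eliminated ≡ a ^ t * Det A
    Det-eliminated-scaled = Det-columnOperations isZero a W W-pivot (λ { i zero _ → refl }) B-other
      where
      isZero : Fin (suc m) → Bool
      isZero zero = true
      isZero (suc _) = false
      W : Fin (suc m) → Fin (suc m) → ℤ
      W zero (suc c) = - A zero (suc c)
      W _ _ = + 0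
      W-pivot : ∀ k j → isZero k ≡ false → W k j ≡ + 0
      W-pivot (suc k) j _ = refl
      B-other : ∀ i j → isZero j ≡ false → eliminated i j ≡ a * A i j + ∑[ k < suc m ] (W k j * A i k)
      B-other i (suc c) _ = cong (_+_ (a * A i (suc c))) (sym (trans
        (cong (_+_ ((- A zero (suc c)) * A i zero)) (sum-zero (λ k → W (suc k) (suc c) * A i (suc k)) λ k → refl))
        (ℤₚ.+-identityʳ _)))

    module _ (v : Fin m → ℤ) where

      β : ℤ
      β = ∑[ c < m ] (A zero (suc c) * v c)

      lift : Fin (suc m) → ℤ
      lift zero = - β
      lift (suc c) = a * v c

      Q″ : ℤ
      Q″ = quadraticForm (λ r c → A (suc r) (suc c)) v

      private
        β-transposed : ∑[ r < m ] (v r * A (suc r) zero) ≡ β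
        β-transposed = sum-cong-≋ {x = λ r → v r * A (suc r) zero} λ r →
          trans (ℤₚ.*-comm (v r) _) (cong (_* v r) (A-sym (suc r) zero))

      schur-form : a * quadraticForm schur v ≡ a * a * Q″ - a * β * β
      schur-form = begin
        a * ∑∑ (λ r c → v r * schur r c * v c)
          ≡⟨ cong (a *_) (∑∑-cong λ r c → expand (v r) a (A (suc r) (suc c)) (A zero (suc c)) (A (suc r) zero) (v c)) ⟩
        a * ∑∑ (λ r c → a * (v r * A (suc r) (suc c) * v c) + -1ℤ * ((v r * A (suc r) zero) * (A zero (suc c) * v c)))
          ≡⟨ cong (a *_) (trans (∑∑-+ (λ r c → a * (v r * A (suc r) (suc c) * v c)) (λ r c → -1ℤ * (columnTerm r * rowTerm c)))
               (cong₂ _+_ (∑∑-scale a (λ r c → v r * A (suc r) (suc c) * v c))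
                          (trans (∑∑-scale -1ℤ (λ r c → columnTerm r * rowTerm c))
                                 (cong (-1ℤ *_) (∑∑-product columnTerm rowTerm))))) ⟩
        a * (a * Q″ + -1ℤ * (∑[ r < m ] (v r * A (suc r) zero) * β))
          ≡⟨ cong (λ z → a * (a * Q″ + -1ℤ * (z * β))) β-transposed ⟩
        a * (a * Q″ + -1ℤ * (β * β))   ≡⟨ collect a Q″ β ⟩
        a * a * Q″ - a * β * β        ∎
        where
        open ≡.≡-Reasoning
        rowTerm columnTerm : Fin m → ℤ
        columnTerm r = v r * A (suc r) zero
        rowTerm c = A zero (suc c) * v c
        expand : ∀ x a p q r y → x * (a * p + (- q) * r) * y ≡ a * (x * p * y) + -1ℤ * ((x * r) * (q * y))
        expand = solve-∀
        collect : ∀ a q b → a * (a * q + -1ℤ * (b * b)) ≡ a * a * q - a * b * b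
        collect = solve-∀

      lift-form : quadraticForm A lift ≡ a * a * Q″ - a * β * β
      lift-form = begin
        ∑∑ (λ i j → lift i * A i j * lift j)                                 ≡⟨ ∑∑-suc (λ i j → lift i * A i j * lift j) ⟩
        ((- β) * a * (- β) + ∑[ c < m ] ((- β) * A zero (suc c) * (a * v c)))
          + (∑[ r < m ] ((a * v r) * A (suc r) zero * (- β)) + ∑∑ (λ r c → (a * v r) * A (suc r) (suc c) * (a * v c)))
          ≡⟨ cong₂ (λ x y → ((- β) * a * (- β) + x) + y) firstRow (cong₂ _+_ firstColumn block) ⟩
        ((- β) * a * (- β) + ((- β) * a) * β) + ((a * (- β)) * β + (a * a) * Q″)  ≡⟨ collect a β Q″ ⟩
        a * a * Q″ - a * β * β                                               ∎
        where
        open ≡.≡-Reasoning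
        collect : ∀ a b q → ((- b) * a * (- b) + ((- b) * a) * b) + ((a * (- b)) * b + (a * a) * q) ≡ a * a * q - a * b * b
        collect = solve-∀
        regroup₁ : ∀ b p a x → b * p * (a * x) ≡ (b * a) * (p * x)
        regroup₁ = solve-∀
        regroup₂ : ∀ a x p b → (a * x) * p * b ≡ (a * b) * (x * p)
        regroup₂ = solve-∀
        regroup₃ : ∀ a x p y → (a * x) * p * (a * y) ≡ (a * a) * (x * p * y)
        regroup₃ = solve-∀
        firstRow : ∑[ c < m ] ((- β) * A zero (suc c) * (a * v c)) ≡ ((- β) * a) * β
        firstRow = trans (sum-cong-≋ {x = λ c → (- β) * A zero (suc c) * (a * v c)} λ c → regroup₁ (- β) (A zero (suc c)) a (v c))
                         (sym (*-distribˡ-sum ((- β) * a) (λ c → A zero (suc c) * v c)))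
        firstColumn : ∑[ r < m ] ((a * v r) * A (suc r) zero * (- β)) ≡ (a * (- β)) * β
        firstColumn = trans (sum-cong-≋ {x = λ r → (a * v r) * A (suc r) zero * (- β)} λ r →
                                         regroup₂ a (v r) (A (suc r) zero) (- β))
                            (trans (sym (*-distribˡ-sum (a * (- β)) (λ r → v r * A (suc r) zero))) (cong ((a * (- β)) *_) β-transposed))
        block : ∑∑ (λ r c → (a * v r) * A (suc r) (suc c) * (a * v c)) ≡ (a * a) * Q″
        block = trans (∑∑-cong λ r c → regroup₃ a (v r) (A (suc r) (suc c)) (v c))
                      (∑∑-scale (a * a) (λ r c → v r * A (suc r) (suc c) * v c))

  Det-positive : ∀ {m} (A : Matrix m) → Symmetric A → PositiveDefinite A → + 0 < Det A
  Det-positive {zero} A _ _ = +<+ (s≤s z≤n)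
  Det-positive {suc m} A A-sym A-pd =
    positive-cancelˡ (^-positive t 0<a) (subst (+ 0 <_) (trans (sym Det-eliminated) scaled) (*-positive 0<a 0<Det-schur))
    where
    open Elimination A A-sym
    t = proj₁ Det-eliminated-scaled
    scaled = proj₂ Det-eliminated-scaled
    0<a : + 0 < a
    0<a = subst (+ 0 <_) (quadraticForm-unit A zero)
      (A-pd (λ i → δ i zero) (zero , λ δ≡0 → 1≢0 (trans (sym (δ-≡ {suc m} zero)) δ≡0)))
      where 1≢0 : + 1 ≢ + 0
            1≢0 ()
    schur-pd : PositiveDefinite schur
    schur-pd v (i , vi≢0) = positive-cancelˡ 0<a (subst (+ 0 <_) (trans (lift-form v) (sym (schur-form v)))
      (A-pd (lift v) (suc i , λ avi≡0 →
        [ (λ a≡0 → ℤₚ.<-irrefl (sym a≡0) 0<a) , vi≢0 ]′ (ℤₚ.i*j≡0⇒i≡0∨j≡0 a avi≡0))))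
    0<Det-schur : + 0 < Det schur
    0<Det-schur = Det-positive schur schur-symmetric schur-pd

module SubsetSize where

  open import Data.Nat using (zero; suc; _≤_; z≤n; s≤s)
  import Data.Nat.Properties as ℕₚ
  open import Data.Fin using (zero; suc)
  open import Data.Fin.Subset using (Subset; inside; outside; ∣_∣; _-_)
  import Data.Fin.Subset.Properties as Subsetₚ
  open import Data.Vec using ([]; _∷_; lookup)
  import Data.Vec.Properties as Vecₚ
  open import Data.Bool using (true)
  open import Data.List using ([]; _∷_; length)
  open import Data.List.Membership.Propositional using (_∈_)
  open import Data.List.Relation.Unary.Any using (here; there)
  open import Data.List.Relation.Unary.Any.Properties using (¬Any[])
  open import Data.List.Relation.Unary.All as All using (All; []; _∷_)
  open import Data.List.Relation.Unary.AllPairs using ([]; _∷_)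
  open import Data.List.Relation.Unary.Unique.Propositional using (Unique)
  open import Data.Product using (_×_; _,_)
  open import Function using (_∘_)
  open import Relation.Binary.PropositionalEquality using (_≡_; _≢_; refl; sym; trans; cong)

  ∣p∣≤1+∣p-x∣ : ∀ {n} (p : Subset n) x → ∣ p ∣ ≤ suc ∣ p - x ∣
  ∣p∣≤1+∣p-x∣ (inside ∷ p) zero = s≤s (ℕₚ.≤-reflexive (cong ∣_∣ (sym (Subsetₚ.p─⊥≡p p))))
  ∣p∣≤1+∣p-x∣ (outside ∷ p) zero = ℕₚ.m≤n⇒m≤1+n (ℕₚ.≤-reflexive (cong ∣_∣ (sym (Subsetₚ.p─⊥≡p p))))
  ∣p∣≤1+∣p-x∣ (inside ∷ p) (suc x) = s≤s (∣p∣≤1+∣p-x∣ p x)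
  ∣p∣≤1+∣p-x∣ (outside ∷ p) (suc x) = ∣p∣≤1+∣p-x∣ p x

  lookup-p-x : ∀ {n} (p : Subset n) x → lookup (p - x) x ≡ outside
  lookup-p-x (_ ∷ p) zero = refl
  lookup-p-x (_ ∷ p) (suc x) = lookup-p-x p x

  length≤∣∣ : ∀ {n} (p : Subset n) {xs} → Unique xs → All (λ j → lookup p j ≡ true) xs → length xs ≤ ∣ p ∣
  length≤∣∣ p {[]} [] [] = z≤n
  length≤∣∣ p {x ∷ xs} (x∉xs ∷ unique) (px ∷ pxs) =
    ℕₚ.<-≤-trans (s≤s (length≤∣∣ (p - x) unique (All.zipWith inRemoved (x∉xs , pxs))))
                 (Subsetₚ.x∈p⇒∣p-x∣<∣p∣ (Vecₚ.lookup⇒[]= x p px))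
    where
    inRemoved : ∀ {j} → x ≢ j × lookup p j ≡ true → lookup (p - x) j ≡ true
    inRemoved (x≢j , pj) = Vecₚ.[]=⇒lookup (Subsetₚ.x∈p∧x∉q⇒x∈p─q (Vecₚ.lookup⇒[]= _ p pj)
                                                                (Subsetₚ.x≢y⇒x∉⁅y⁆ (x≢j ∘ sym)))

  ∣∣≤length : ∀ {n} (p : Subset n) xs → (∀ j → lookup p j ≡ true → j ∈ xs) → ∣ p ∣ ≤ length xs
  ∣∣≤length {n} p [] p⊆[] = ℕₚ.≤-reflexive (trans (cong ∣_∣ (Subsetₚ.Empty-unique {p = p} λ { (j , j∈p) →
                                 ¬Any[] (p⊆[] j (Vecₚ.[]=⇒lookup j∈p)) })) (Subsetₚ.∣⊥∣≡0 n))
  ∣∣≤length p (x ∷ xs) p⊆x∷xs = ℕₚ.≤-trans (∣p∣≤1+∣p-x∣ p x) (s≤s (∣∣≤length (p - x) xs inTail))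
    where
    inTail : ∀ j → lookup (p - x) j ≡ true → j ∈ xs
    inTail j pj with p⊆x∷xs j (Vecₚ.[]=⇒lookup (Subsetₚ.p─q⊆p p _ (Vecₚ.lookup⇒[]= j _ pj)))
    ... | here refl with () ← trans (sym pj) (lookup-p-x p j)
    ... | there j∈xs = j∈xs

module Graph {m} (Adj : Fin m → Fin m → Set) (adj? : ∀ i j → Dec (Adj i j)) (adj-sym : ∀ {i j} → Adj i j → Adj j i) where

  open import Data.Nat using (ℕ; zero; suc; _≤_; s≤s)
  import Data.Nat.Properties as ℕₚ
  open import Data.Fin as Fin using (Fin; zero; suc)
  import Data.Fin.Properties as Finₚ
  open import Data.Fin.Subset using (Subset; ∣_∣; ⊤)
  import Data.Fin.Subset.Properties as Subsetₚ
  open import Data.Vec using ([]; _∷_; lookup; tabulate)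
  import Data.Vec.Properties as Vecₚ
  open import Data.Bool using (true; false)
  import Data.Bool.Properties as Boolₚ
  open import Data.List using (List; []; _∷_; length; allFin)
  open import Data.List.Membership.Propositional using (_∈_)
  import Data.List.Membership.DecPropositional as DecMembership
  open import Data.List.Membership.Propositional.Properties using (∈-allFin)
  open import Data.List.Relation.Unary.Any as Any using (Any; here; there)
  open import Data.List.Relation.Unary.All as All using (All; []; _∷_)
  open import Data.List.Relation.Unary.All.Properties using (¬Any⇒All¬; ¬All⇒Any¬)
  open import Data.List.Relation.Unary.AllPairs using (AllPairs; []; _∷_)
  open import Data.List.Relation.Unary.Unique.Propositional using (Unique)
  open import Data.Product using (∃-syntax; _×_; _,_; proj₂)
  open import Data.Sum using (_⊎_; inj₁; inj₂)
  open import Data.Empty using (⊥-elim)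
  open import Function using (_∘_)
  open import Relation.Nullary using (Dec; yes; no; ¬_; does)
  open import Relation.Nullary.Decidable using (_×-dec_; _⊎-dec_)
  import Relation.Nullary.Decidable as Decidable
  open import Relation.Binary.Definitions using (DecidableEquality)
  open import Relation.Binary.PropositionalEquality as ≡ using (_≡_; _≢_; refl; sym; trans; cong)

  open SubsetSize

  data Path : Fin m → Fin m → List (Fin m) → Set where
    stop : ∀ {i} → Path i i (i ∷ [])
    step : ∀ {i k j xs} → Adj i k → Path k j xs → Path i j (i ∷ xs)

  Connected : Fin m → Fin m → Set
  Connected i j = ∃[ xs ] Path i j xs

  connected-refl : ∀ {i} → Connected i i
  connected-refl = _ , stop

  connected-step : ∀ {i k j} → Adj i k → Connected k j → Connected i j
  connected-step i~k (_ , path) = _ , step i~k path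

  connected-trans : ∀ {i j k} → Connected i j → Connected j k → Connected i k
  connected-trans (_ , stop) j~k = j~k
  connected-trans (_ , step i~l path) j~k = connected-step i~l (connected-trans (_ , path) j~k)

  connected-sym : ∀ {i j} → Connected i j → Connected j i
  connected-sym (_ , stop) = connected-refl
  connected-sym (_ , step i~k path) = connected-trans (connected-sym (_ , path)) (connected-step (adj-sym i~k) connected-refl)

  SimplePath : Fin m → Fin m → Set
  SimplePath i j = ∃[ xs ] Path i j xs × Unique xs

  private
    suffix : ∀ {u j ys i} → Path u j ys → Unique ys → i ∈ ys → SimplePath i j
    suffix stop unique (here refl) = _ , stop , unique
    suffix (step u~k path) unique (here refl) = _ , step u~k path , unique
    suffix (step _ path) (_ ∷ unique) (there i∈ys) = suffix path unique i∈ys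

  eraseLoops : ∀ {i j xs} → Path i j xs → SimplePath i j
  eraseLoops stop = _ , stop , [] ∷ []
  eraseLoops {i} (step i~k path) with ys , simple , unique ← eraseLoops path | Any.any? (i Fin.≟_) ys
  ... | yes i∈ys = suffix simple unique i∈ys
  ... | no i∉ys = _ , step i~k simple , ¬Any⇒All¬ ys i∉ys ∷ unique

  ReachableWithin : ℕ → Fin m → Fin m → Set
  ReachableWithin zero i j = i ≡ j
  ReachableWithin (suc t) i j = i ≡ j ⊎ ∃[ k ] Adj i k × ReachableWithin t k j

  reachableWithin? : ∀ t i j → Dec (ReachableWithin t i j)
  reachableWithin? zero i j = i Fin.≟ j
  reachableWithin? (suc t) i j = (i Fin.≟ j) ⊎-dec Finₚ.any? (λ k → adj? i k ×-dec reachableWithin? t k j)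

  reachableWithin⇒connected : ∀ t {i j} → ReachableWithin t i j → Connected i j
  reachableWithin⇒connected zero refl = connected-refl
  reachableWithin⇒connected (suc t) (inj₁ refl) = connected-refl
  reachableWithin⇒connected (suc t) (inj₂ (k , i~k , reach)) = connected-step i~k (reachableWithin⇒connected t reach)

  path⇒reachableWithin : ∀ {i j xs} → Path i j xs → ∀ t → length xs ≤ suc t → ReachableWithin t i j
  path⇒reachableWithin stop zero _ = refl
  path⇒reachableWithin stop (suc t) _ = inj₁ refl
  path⇒reachableWithin (step i~k path) (suc t) (s≤s len≤) = inj₂ (_ , i~k , path⇒reachableWithin path t len≤)
  path⇒reachableWithin (step _ stop) zero (s≤s ())
  path⇒reachableWithin (step _ (step _ _)) zero (s≤s ())

  unique-length≤ : ∀ {xs : List (Fin m)} → Unique xs → length xs ≤ m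
  unique-length≤ {xs} unique =
    ℕₚ.≤-trans (length≤∣∣ ⊤ unique (All.tabulate λ {j} _ → Vecₚ.[]=⇒lookup (Subsetₚ.∈⊤ {x = j})))
                                         (ℕₚ.≤-reflexive (Subsetₚ.∣⊤∣≡n m))

  -- A simple path has at most m vertices, so bounded search decides connectivity.
  connected? : ∀ i j → Dec (Connected i j)
  connected? i j with reachableWithin? m i j
  ... | yes reach = yes (reachableWithin⇒connected m reach)
  ... | no ¬reach = no λ i~j → let (_ , path , unique) = eraseLoops (proj₂ i~j) in
                         ¬reach (path⇒reachableWithin path m (ℕₚ.m≤n⇒m≤1+n (unique-length≤ unique)))

  private
    greedy : List (Fin m) → List (Fin m)
    greedy [] = []
    greedy (x ∷ xs) with Any.any? (connected? x) (greedy xs)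
    ... | yes _ = greedy xs
    ... | no _ = x ∷ greedy xs

    greedy-disconnected : ∀ xs → AllPairs (λ a b → ¬ Connected a b) (greedy xs)
    greedy-disconnected [] = []
    greedy-disconnected (x ∷ xs) with Any.any? (connected? x) (greedy xs)
    ... | yes _ = greedy-disconnected xs
    ... | no x≁greedy = ¬Any⇒All¬ _ x≁greedy ∷ greedy-disconnected xs

    greedy-cover : ∀ xs {x} → x ∈ xs → Any (Connected x) (greedy xs)
    greedy-cover (y ∷ xs) x∈ with Any.any? (connected? y) (greedy xs)
    greedy-cover (y ∷ xs) (here refl) | yes y~greedy = y~greedy
    greedy-cover (y ∷ xs) (there x∈xs) | yes _ = greedy-cover xs x∈xs
    greedy-cover (y ∷ xs) (here refl) | no _ = here connected-refl
    greedy-cover (y ∷ xs) (there x∈xs) | no _ = there (greedy-cover xs x∈xs)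

  representatives : List (Fin m)
  representatives = greedy (allFin m)

  representatives-disconnected : AllPairs (λ a b → ¬ Connected a b) representatives
  representatives-disconnected = greedy-disconnected (allFin m)

  representatives-cover : ∀ i → Any (Connected i) representatives
  representatives-cover i = greedy-cover (allFin m) (∈-allFin i)

  Meets : Subset m → Fin m → Set
  Meets s r = ∃[ j ] lookup s j ≡ true × Connected j r

  MeetsAllComponents : Subset m → Set
  MeetsAllComponents s = All (Meets s) representatives

  meets? : ∀ s r → Dec (Meets s r)
  meets? s r = Finₚ.any? λ j → (lookup s j Boolₚ.≟ true) ×-dec connected? j r

  meetsAllComponents? : ∀ s → Dec (MeetsAllComponents s)
  meetsAllComponents? s = All.all? (meets? s) representatives

  missesComponent : ∀ s → ¬ MeetsAllComponents s → ∃[ r ] ∀ j → Connected j r → lookup s j ≡ false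
  missesComponent s ¬meets with r , r∉s ← Any.satisfied (¬All⇒Any¬ (meets? s) representatives ¬meets) =
    r , λ j j~r → outside? j j~r (lookup s j) refl
    where
    outside? : ∀ j → Connected j r → ∀ b → lookup s j ≡ b → lookup s j ≡ false
    outside? j j~r true sj = ⊥-elim (r∉s (j , sj , j~r))
    outside? j j~r false sj = sj

  private
    witnesses : ∀ s rs → All (Meets s) rs → List (Fin m)
    witnesses s [] [] = []
    witnesses s (r ∷ rs) ((j , _) ∷ meets) = j ∷ witnesses s rs meets

    witnesses-length : ∀ s rs (meets : All (Meets s) rs) → length (witnesses s rs meets) ≡ length rs
    witnesses-length s [] [] = refl
    witnesses-length s (r ∷ rs) (_ ∷ meets) = cong suc (witnesses-length s rs meets)

    witnesses-inside : ∀ s rs (meets : All (Meets s) rs) → All (λ j → lookup s j ≡ true) (witnesses s rs meets)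
    witnesses-inside s [] [] = []
    witnesses-inside s (r ∷ rs) ((_ , sj , _) ∷ meets) = sj ∷ witnesses-inside s rs meets

    witnesses-unique : ∀ s rs → AllPairs (λ a b → ¬ Connected a b) rs → (meets : All (Meets s) rs) →
                       Unique (witnesses s rs meets)
    witnesses-unique s [] [] [] = []
    witnesses-unique s (r ∷ rs) (r≁rs ∷ disconnected) ((j , _ , j~r) ∷ meets) =
      distinct rs r≁rs meets ∷ witnesses-unique s rs disconnected meets
      where
      distinct : ∀ rs′ → All (λ b → ¬ Connected r b) rs′ → (meets′ : All (Meets s) rs′) →
                 All (j ≢_) (witnesses s rs′ meets′)
      distinct [] [] [] = []
      distinct (r′ ∷ rs′) (r≁r′ ∷ r≁rs′) ((j′ , _ , j′~r′) ∷ meets′) =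
        (λ { refl → r≁r′ (connected-trans (connected-sym j~r) j′~r′) }) ∷ distinct rs′ r≁rs′ meets′

  #components≤∣∣ : ∀ s → MeetsAllComponents s → length representatives ≤ ∣ s ∣
  #components≤∣∣ s meets = ≡.subst (_≤ ∣ s ∣) (witnesses-length s representatives meets)
    (length≤∣∣ s (witnesses-unique s representatives representatives-disconnected meets)
                 (witnesses-inside s representatives meets))

  open DecMembership (Fin._≟_ {m}) using (_∈?_)

  transversal : Subset m
  transversal = tabulate λ j → does (j ∈? representatives)

  private
    transversal-∈ : ∀ {j} → j ∈ representatives → lookup transversal j ≡ true
    transversal-∈ {j} j∈reps = trans (Vecₚ.lookup∘tabulate _ j) (Decidable.dec-true (j ∈? representatives) j∈reps)

    transversal-⊆ : ∀ j → lookup transversal j ≡ true → j ∈ representatives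
    transversal-⊆ j tj with j ∈? representatives | trans (sym (Vecₚ.lookup∘tabulate _ j)) tj
    ... | yes j∈reps | _ = j∈reps
    ... | no _ | ()

  transversal-meets : MeetsAllComponents transversal
  transversal-meets = All.tabulate λ {r} r∈reps → r , transversal-∈ r∈reps , connected-refl

  ∣transversal∣ : ∣ transversal ∣ ≡ length representatives
  ∣transversal∣ = ℕₚ.≤-antisym (∣∣≤length transversal representatives transversal-⊆)
                               (#components≤∣∣ transversal transversal-meets)

  changingEdge : ∀ {A : Set} (_≟_ : DecidableEquality A) (w : Fin m → A) {i j xs} → Path i j xs → w i ≢ w j →
                 ∃[ p ] ∃[ q ] Adj p q × w p ≢ w q
  changingEdge _≟_ w stop wi≢wj = ⊥-elim (wi≢wj refl)
  changingEdge _≟_ w {i} (step {k = k} i~k path) wi≢wj with w i ≟ w k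
  ... | yes wi≡wk = changingEdge _≟_ w path (wi≢wj ∘ trans wi≡wk)
  ... | no wi≢wk = i , k , i~k , wi≢wk

module IntegerInequalities where

  open import Data.Nat using (zero; suc; z≤n; s≤s)
  open import Data.Integer using (ℤ; +_; _+_; _*_; _≤_; _<_; +≤+; +<+; +[1+_]; -[1+_])
  import Data.Integer.Properties as ℤₚ
  open import Data.Fin using (Fin; zero; suc)
  open import Data.Fin.Subset using (Subset; inside; outside)
  open import Data.Vec using ([]; _∷_)
  open import Data.Empty using (⊥-elim)
  open import Function using (_∘_)
  open import Relation.Binary.PropositionalEquality using (_≡_; _≢_; refl; cong₂; subst)

  open Determinant ℤₚ.+-*-commutativeRing using (sum; sumSubsets)
  open PositiveDefinite using (∑∑)

  sum-nonneg : ∀ {k} (f : Fin k → ℤ) → (∀ j → + 0 ≤ f j) → + 0 ≤ sum f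
  sum-nonneg {zero} f f≥0 = +≤+ z≤n
  sum-nonneg {suc k} f f≥0 = ℤₚ.+-mono-≤ (f≥0 zero) (sum-nonneg (f ∘ suc) (f≥0 ∘ suc))

  term≤sum : ∀ {k} (f : Fin k → ℤ) → (∀ j → + 0 ≤ f j) → ∀ j → f j ≤ sum f
  term≤sum {suc k} f f≥0 zero =
    subst (_≤ sum f) (ℤₚ.+-identityʳ (f zero)) (ℤₚ.+-monoʳ-≤ (f zero) (sum-nonneg (f ∘ suc) (f≥0 ∘ suc)))
  term≤sum {suc k} f f≥0 (suc j) =
    subst (_≤ sum f) (ℤₚ.+-identityˡ (f (suc j))) (ℤₚ.+-mono-≤ (f≥0 zero) (term≤sum (f ∘ suc) (f≥0 ∘ suc) j))

  ∑∑-nonneg : ∀ {k} (f : Fin k → Fin k → ℤ) → (∀ i j → + 0 ≤ f i j) → + 0 ≤ ∑∑ f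
  ∑∑-nonneg f f≥0 = sum-nonneg _ λ i → sum-nonneg (f i) (f≥0 i)

  term≤∑∑ : ∀ {k} (f : Fin k → Fin k → ℤ) → (∀ i j → + 0 ≤ f i j) → ∀ i j → f i j ≤ ∑∑ f
  term≤∑∑ f f≥0 i j = ℤₚ.≤-trans (term≤sum (f i) (f≥0 i) j) (term≤sum _ (λ i → sum-nonneg (f i) (f≥0 i)) i)

  sumSubsets-zero : ∀ k (g : Subset k → ℤ) → (∀ s → g s ≡ + 0) → sumSubsets k g ≡ + 0
  sumSubsets-zero zero g g≡0 = g≡0 _
  sumSubsets-zero (suc k) g g≡0 =
    cong₂ _+_ (sumSubsets-zero k _ (g≡0 ∘ (inside ∷_))) (sumSubsets-zero k _ (g≡0 ∘ (outside ∷_)))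

  sumSubsets-nonneg : ∀ k (g : Subset k → ℤ) → (∀ s → + 0 ≤ g s) → + 0 ≤ sumSubsets k g
  sumSubsets-nonneg zero g g≥0 = g≥0 _
  sumSubsets-nonneg (suc k) g g≥0 =
    ℤₚ.+-mono-≤ (sumSubsets-nonneg k _ (g≥0 ∘ (inside ∷_))) (sumSubsets-nonneg k _ (g≥0 ∘ (outside ∷_)))

  sumSubsets-positive : ∀ k (g : Subset k → ℤ) → (∀ s → + 0 ≤ g s) → ∀ s₀ → + 0 < g s₀ → + 0 < sumSubsets k g
  sumSubsets-positive zero g g≥0 [] g>0 = g>0
  sumSubsets-positive (suc k) g g≥0 (inside ∷ s₀) g>0 = ℤₚ.+-mono-<-≤
    (sumSubsets-positive k _ (g≥0 ∘ (inside ∷_)) s₀ g>0) (sumSubsets-nonneg k _ (g≥0 ∘ (outside ∷_)))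
  sumSubsets-positive (suc k) g g≥0 (outside ∷ s₀) g>0 = ℤₚ.+-mono-≤-<
    (sumSubsets-nonneg k _ (g≥0 ∘ (inside ∷_))) (sumSubsets-positive k _ (g≥0 ∘ (outside ∷_)) s₀ g>0)

  square-nonneg : ∀ x → + 0 ≤ x * x
  square-nonneg (+ n) = subst (+ 0 ≤_) (ℤₚ.pos-* n n) (+≤+ z≤n)
  square-nonneg -[1+ n ] = +≤+ z≤n

  square-positive : ∀ x → x ≢ + 0 → + 0 < x * x
  square-positive (+ zero) x≢0 = ⊥-elim (x≢0 refl)
  square-positive +[1+ n ] _ = +<+ (s≤s z≤n)
  square-positive -[1+ n ] _ = +<+ (s≤s z≤n)

module Laplacian {m} (Adj : Fin m → Fin m → Set) (adj? : ∀ i j → Dec (Adj i j))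
                 (adj-sym : ∀ {i j} → Adj i j → Adj j i) where

  open import Data.Nat using (zero; suc; z≤n; s≤s)
  open import Data.Integer as ℤ using (ℤ; +_; -_; -1ℤ; 1ℤ; _+_; _-_; _*_; _≤_; _<_; +≤+; +<+)
  import Data.Integer.Properties as ℤₚ
  open import Data.Integer.Tactic.RingSolver using (solve-∀)
  open import Data.Fin using (Fin; zero; suc; _≟_)
  open import Data.Fin.Subset using (Subset)
  open import Data.Vec using (lookup)
  open import Data.Bool using (true; false; if_then_else_)
  import Data.List.Relation.Unary.All as All
  open import Data.List.Membership.Propositional using (find)
  open import Data.Product using (_,_; proj₁; proj₂)
  open import Data.Empty using (⊥-elim)
  open import Function using (_∘_)
  open import Relation.Nullary using (Dec; yes; no; ¬_; does)
  open import Relation.Binary.PropositionalEquality as ≡ using (_≡_; _≢_; refl; sym; trans; cong; cong₂; subst; subst₂)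

  open Graph Adj adj? adj-sym
  open Determinant ℤₚ.+-*-commutativeRing
    using (Matrix; Det; sum; sum-syntax; sum-cong-≋; sum-zero; sum-single; ∑-distrib-+; ∑-comm;
           *-distribˡ-sum; *-distribʳ-sum; δ; δ-≡; δ-≢; δ-sym; setColumn; setColumn-≡;
           Det-combination; Det-zeroColumn; Det-columnOperations; _^_)
  open PositiveDefinite
  open IntegerInequalities
  open CharacteristicPolynomial using (withUnitColumns)

  adjacency : Matrix m
  adjacency i j = if does (adj? i j) then + 1 else + 0

  degree : Fin m → ℤ
  degree i = sum (adjacency i)

  laplacian : Matrix m
  laplacian i j = δ i j * degree i - adjacency i j

  adjacency-adj : ∀ {i j} → Adj i j → adjacency i j ≡ + 1
  adjacency-adj {i} {j} i~j with adj? i j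
  ... | yes _ = refl
  ... | no i≁j = ⊥-elim (i≁j i~j)

  adjacency-¬adj : ∀ {i j} → ¬ Adj i j → adjacency i j ≡ + 0
  adjacency-¬adj {i} {j} i≁j with adj? i j
  ... | yes i~j = ⊥-elim (i≁j i~j)
  ... | no _ = refl

  adjacency-sym : ∀ i j → adjacency i j ≡ adjacency j i
  adjacency-sym i j with adj? j i
  ... | yes j~i = adjacency-adj (adj-sym j~i)
  ... | no j≁i = adjacency-¬adj (j≁i ∘ adj-sym)

  laplacian-sym : Symmetric laplacian
  laplacian-sym i j = byCases (i ≟ j)
    where
    byCases : ∀ {j} → Dec (i ≡ j) → laplacian i j ≡ laplacian j i
    byCases (yes refl) = refl
    byCases {j} (no i≢j) = cong₂ _-_ (trans (cong (_* degree i) (δ-≢ i≢j)) (sym (cong (_* degree j) (δ-≢ (i≢j ∘ sym)))))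
                                     (adjacency-sym i j)

  laplacian-unrelated : ∀ {i j} → i ≢ j → ¬ Adj i j → laplacian i j ≡ + 0
  laplacian-unrelated {i} i≢j i≁j = cong₂ (λ d a → d * degree i - a) (δ-≢ i≢j) (adjacency-¬adj i≁j)

  laplacian-rowSum : ∀ i → sum (laplacian i) ≡ + 0
  laplacian-rowSum i = begin
    ∑[ j < m ] (δ i j * degree i - adjacency i j)           ≡⟨ ∑-distrib-+ (λ j → δ i j * degree i) (λ j → - adjacency i j) ⟩
    ∑[ j < m ] (δ i j * degree i) + ∑[ j < m ] (- adjacency i j)
      ≡⟨ cong₂ _+_ (sum-single i _ λ j j≢i → cong (_* degree i) (δ-≢ (j≢i ∘ sym)))
                   (trans (sum-cong-≋ {x = λ j → - adjacency i j} λ j → sym (ℤₚ.-1*i≡-i _))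
                          (sym (*-distribˡ-sum -1ℤ (adjacency i)))) ⟩
    δ i i * degree i + -1ℤ * degree i                       ≡⟨ cong (λ d → d * degree i + -1ℤ * degree i) (δ-≡ i) ⟩
    + 1 * degree i + -1ℤ * degree i                         ≡⟨ cancel (degree i) ⟩
    + 0                                                     ∎
    where
    open ≡.≡-Reasoning
    cancel : ∀ d → + 1 * d + -1ℤ * d ≡ + 0
    cancel = solve-∀

  module _ (w : Fin m → ℤ) where

    private
      diagonalPart crossPart : ℤ
      diagonalPart = ∑[ i < m ] (degree i * (w i * w i))
      crossPart = ∑∑ (λ i j → adjacency i j * (w i * w j))

      rowScale : ∀ i x → ∑[ j < m ] (adjacency i j * x) ≡ degree i * x
      rowScale i x = sym (*-distribʳ-sum x (adjacency i))

      form-split : quadraticForm laplacian w ≡ diagonalPart + -1ℤ * crossPart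
      form-split = begin
        ∑∑ (λ i j → w i * laplacian i j * w j)
          ≡⟨ ∑∑-cong (λ i j → expand (w i) (δ i j) (degree i) (adjacency i j) (w j)) ⟩
        ∑∑ (λ i j → δ i j * (degree i * (w i * w j)) + -1ℤ * (adjacency i j * (w i * w j)))
          ≡⟨ ∑∑-+ (λ i j → δ i j * (degree i * (w i * w j))) (λ i j → -1ℤ * (adjacency i j * (w i * w j))) ⟩
        ∑∑ (λ i j → δ i j * (degree i * (w i * w j))) + ∑∑ (λ i j → -1ℤ * (adjacency i j * (w i * w j)))
          ≡⟨ cong₂ _+_ diagonal (∑∑-scale -1ℤ (λ i j → adjacency i j * (w i * w j))) ⟩
        diagonalPart + -1ℤ * crossPart   ∎
        where
        open ≡.≡-Reasoning
        expand : ∀ x d g a y → x * (d * g - a) * y ≡ d * (g * (x * y)) + -1ℤ * (a * (x * y))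
        expand = solve-∀
        diagonal : ∑∑ (λ i j → δ i j * (degree i * (w i * w j))) ≡ diagonalPart
        diagonal = sum-cong-≋ {x = λ i → ∑[ j < m ] (δ i j * (degree i * (w i * w j)))} λ i →
          trans (sum-single i (λ j → δ i j * (degree i * (w i * w j))) λ j j≢i →
                   cong (_* (degree i * (w i * w j))) (δ-≢ (j≢i ∘ sym)))
                (trans (cong (_* (degree i * (w i * w i))) (δ-≡ i)) (ℤₚ.*-identityˡ _))

      edgeSum-split : ∑∑ (λ i j → adjacency i j * ((w i - w j) * (w i - w j))) ≡
                      diagonalPart + + 2 * (-1ℤ * crossPart) + diagonalPart
      edgeSum-split = begin
        ∑∑ (λ i j → adjacency i j * ((w i - w j) * (w i - w j)))
          ≡⟨ ∑∑-cong (λ i j → expand (adjacency i j) (w i) (w j)) ⟩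
        ∑∑ (λ i j → (adjacency i j * (w i * w i) + + 2 * (-1ℤ * (adjacency i j * (w i * w j)))) + adjacency i j * (w j * w j))
          ≡⟨ trans (∑∑-+ (λ i j → adjacency i j * (w i * w i) + + 2 * (-1ℤ * cross i j)) (λ i j → adjacency i j * (w j * w j)))
                   (cong (_+ ∑∑ (λ i j → adjacency i j * (w j * w j)))
                         (trans (∑∑-+ (λ i j → adjacency i j * (w i * w i)) (λ i j → + 2 * (-1ℤ * cross i j)))
                                (cong (_+_ (∑∑ (λ i j → adjacency i j * (w i * w i))))
                                      (trans (∑∑-scale (+ 2) (λ i j → -1ℤ * cross i j))
                                             (cong (_*_ (+ 2)) (∑∑-scale -1ℤ cross)))))) ⟩
        (∑∑ (λ i j → adjacency i j * (w i * w i)) + + 2 * (-1ℤ * crossPart)) + ∑∑ (λ i j → adjacency i j * (w j * w j))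
          ≡⟨ cong₂ (λ x y → (x + + 2 * (-1ℤ * crossPart)) + y) fromRows fromColumns ⟩
        diagonalPart + + 2 * (-1ℤ * crossPart) + diagonalPart   ∎
        where
        open ≡.≡-Reasoning
        cross : Fin m → Fin m → ℤ
        cross i j = adjacency i j * (w i * w j)
        expand : ∀ a x y → a * ((x - y) * (x - y)) ≡ (a * (x * x) + + 2 * (-1ℤ * (a * (x * y)))) + a * (y * y)
        expand = solve-∀
        fromRows : ∑∑ (λ i j → adjacency i j * (w i * w i)) ≡ diagonalPart
        fromRows = sum-cong-≋ {x = λ i → ∑[ j < m ] (adjacency i j * (w i * w i))} λ i → rowScale i (w i * w i)
        fromColumns : ∑∑ (λ i j → adjacency i j * (w j * w j)) ≡ diagonalPart
        fromColumns = trans (∑-comm (λ i j → adjacency i j * (w j * w j)))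
          (sum-cong-≋ {x = λ j → ∑[ i < m ] (adjacency i j * (w j * w j))} λ j →
            trans (sum-cong-≋ {x = λ i → adjacency i j * (w j * w j)} λ i → cong (_* (w j * w j)) (adjacency-sym i j))
                  (rowScale j (w j * w j)))

      edgeTerm-nonneg : ∀ i j → + 0 ≤ adjacency i j * ((w i - w j) * (w i - w j))
      edgeTerm-nonneg i j with does (adj? i j)
      ... | true = subst (+ 0 ≤_) (sym (ℤₚ.*-identityˡ _)) (square-nonneg (w i - w j))
      ... | false = +≤+ z≤n

    twice-laplacianForm : + 2 * quadraticForm laplacian w ≡ ∑∑ (λ i j → adjacency i j * ((w i - w j) * (w i - w j)))
    twice-laplacianForm = trans (cong (+ 2 *_) form-split) (trans (double diagonalPart crossPart) (sym edgeSum-split))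
      where
      double : ∀ d x → + 2 * (d + -1ℤ * x) ≡ d + + 2 * (-1ℤ * x) + d
      double = solve-∀

    laplacianForm-nonneg : + 0 ≤ quadraticForm laplacian w
    laplacianForm-nonneg = ℤₚ.*-cancelˡ-≤-pos (+ 0) (quadraticForm laplacian w) (+ 2)
      (subst₂ _≤_ (sym (ℤₚ.*-zeroʳ (+ 2))) (sym twice-laplacianForm) (∑∑-nonneg _ edgeTerm-nonneg))

    laplacianForm-positive : ∀ {p q} → Adj p q → w p ≢ w q → + 0 < quadraticForm laplacian w
    laplacianForm-positive {p} {q} p~q wp≢wq = positive-cancelˡ {+ 2} {quadraticForm laplacian w} (+<+ (s≤s z≤n))
      (subst (+ 0 <_) (sym twice-laplacianForm) (ℤₚ.<-≤-trans edgeTerm-positive (term≤∑∑ _ edgeTerm-nonneg p q)))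
      where
      edgeTerm-positive : + 0 < adjacency p q * ((w p - w q) * (w p - w q))
      edgeTerm-positive = subst (+ 0 <_) (sym (trans (cong (_* ((w p - w q) * (w p - w q))) (adjacency-adj p~q)) (ℤₚ.*-identityˡ _)))
        (square-positive (w p - w q) (wp≢wq ∘ ℤₚ.i-j≡0⇒i≡j (w p) (w q)))

  inside≢outside : ∀ (s : Subset m) {i j} → lookup s i ≡ false → lookup s j ≡ true → i ≢ j
  inside≢outside s {i} si sj refl with () ← trans (sym si) sj

  reduced : Subset m → Matrix m
  reduced s i j = if lookup s j then δ i j else (if lookup s i then + 0 else laplacian i j)

  reduced-symmetric : ∀ s → Symmetric (reduced s)
  reduced-symmetric s i j with lookup s i in si | lookup s j in sj
  ... | true | true = δ-sym i j
  ... | true | false = sym (δ-≢ {i = j} {i} (inside≢outside s sj si))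
  ... | false | true = δ-≢ {i = i} {j} (inside≢outside s si sj)
  ... | false | false = laplacian-sym i j

  outsidePart : Subset m → (Fin m → ℤ) → Fin m → ℤ
  outsidePart s v i = if lookup s i then + 0 else v i

  insideSquare : Subset m → (Fin m → ℤ) → Fin m → ℤ
  insideSquare s v i = if lookup s i then v i * v i else + 0

  insideSquare-nonneg : ∀ s v i → + 0 ≤ insideSquare s v i
  insideSquare-nonneg s v i with lookup s i
  ... | true = square-nonneg (v i)
  ... | false = +≤+ z≤n

  reduced-form : ∀ s v → quadraticForm (reduced s) v ≡ sum (insideSquare s v) + quadraticForm laplacian (outsidePart s v)
  reduced-form s v = begin
    ∑∑ (λ i j → v i * reduced s i j * v j)
      ≡⟨ ∑∑-cong split ⟩
    ∑∑ (λ i j → insideTerm i j + w i * laplacian i j * w j)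
      ≡⟨ ∑∑-+ insideTerm (λ i j → w i * laplacian i j * w j) ⟩
    ∑∑ insideTerm + quadraticForm laplacian w
      ≡⟨ cong (_+ quadraticForm laplacian w) (sum-cong-≋ {x = λ i → sum (insideTerm i)} diagonal) ⟩
    sum (insideSquare s v) + quadraticForm laplacian w   ∎
    where
    open ≡.≡-Reasoning
    w = outsidePart s v
    insideTerm : Fin m → Fin m → ℤ
    insideTerm i j = if lookup s j then δ i j * (v i * v j) else + 0
    split : ∀ i j → v i * reduced s i j * v j ≡ insideTerm i j + w i * laplacian i j * w j
    split i j with lookup s i | lookup s j
    ... | true | true = bothInside (v i) (δ i j) (v j) (laplacian i j)
      where bothInside : ∀ x d y l → x * d * y ≡ d * (x * y) + + 0 * l * + 0
            bothInside = solve-∀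
    ... | false | true = columnInside (v i) (δ i j) (v j) (laplacian i j)
      where columnInside : ∀ x d y l → x * d * y ≡ d * (x * y) + x * l * + 0
            columnInside = solve-∀
    ... | true | false = rowInside (v i) (v j) (laplacian i j)
      where rowInside : ∀ x y l → x * + 0 * y ≡ + 0 + + 0 * l * y
            rowInside = solve-∀
    ... | false | false = sym (ℤₚ.+-identityˡ _)
    diagonal : ∀ i → sum (insideTerm i) ≡ insideSquare s v i
    diagonal i = trans (sum-single i (insideTerm i) offDiagonal) onDiagonal
      where
      offDiagonal : ∀ j → j ≢ i → insideTerm i j ≡ + 0
      offDiagonal j j≢i with lookup s j
      ... | true = cong (_* (v i * v j)) (δ-≢ (j≢i ∘ sym))
      ... | false = refl
      onDiagonal : insideTerm i i ≡ insideSquare s v i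
      onDiagonal with lookup s i
      ... | true = trans (cong (_* (v i * v i)) (δ-≡ i)) (ℤₚ.*-identityˡ _)
      ... | false = refl

  reduced-positiveDefinite : ∀ s → MeetsAllComponents s → PositiveDefinite (reduced s)
  reduced-positiveDefinite s meets v (k , vk≢0) = subst (+ 0 <_) (sym (reduced-form s v)) (byMembership (lookup s k) refl)
    where
    w = outsidePart s v
    byMembership : ∀ b → lookup s k ≡ b → + 0 < sum (insideSquare s v) + quadraticForm laplacian w
    byMembership true sk = ℤₚ.+-mono-<-≤
      (ℤₚ.<-≤-trans (subst (+ 0 <_) (cong (λ b → if b then v k * v k else + 0) (sym sk)) (square-positive (v k) vk≢0))
                    (term≤sum (insideSquare s v) (insideSquare-nonneg s v) k))
      (laplacianForm-nonneg w)
    byMembership false sk = ℤₚ.+-mono-≤-< (sum-nonneg (insideSquare s v) (insideSquare-nonneg s v)) outsideForm-positive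
      where
      -- s meets the component of k in some j, where w vanishes although w k = v k ≠ 0.
      outsideForm-positive : + 0 < quadraticForm laplacian w
      outsideForm-positive =
        let r , r∈reps , k~r = find (representatives-cover k)
            j , sj , j~r = All.lookup meets r∈reps
            wk≢wj : w k ≢ w j
            wk≢wj wk≡wj = vk≢0 (trans (cong (λ b → if b then + 0 else v k) (sym sk))
                                      (trans wk≡wj (cong (λ b → if b then + 0 else v j) sj)))
            p , q , p~q , wp≢wq = changingEdge ℤ._≟_ w (proj₂ (connected-trans k~r (connected-sym j~r))) wk≢wj
        in laplacianForm-positive w p~q wp≢wq

  1^t≡1 : ∀ t → 1ℤ ^ t ≡ 1ℤ
  1^t≡1 zero = refl
  1^t≡1 (suc t) = trans (ℤₚ.*-identityˡ (1ℤ ^ t)) (1^t≡1 t)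

  Det-withUnitColumns≡Det-reduced : ∀ s → Det (withUnitColumns s laplacian) ≡ Det (reduced s)
  Det-withUnitColumns≡Det-reduced s =
    sym (trans (proj₂ scaled) (trans (cong (_* Det K) (1^t≡1 (proj₁ scaled))) (ℤₚ.*-identityˡ (Det K))))
    where
    K = withUnitColumns s laplacian
    W : Fin m → Fin m → ℤ
    W k j = if lookup s k then - laplacian k j else + 0
    W-pivot : ∀ k j → lookup s k ≡ false → W k j ≡ + 0
    W-pivot k j sk = cong (λ b → if b then - laplacian k j else + 0) sk
    B-pivot : ∀ i j → lookup s j ≡ true → reduced s i j ≡ K i j
    B-pivot i j sj = trans (cong (λ b → if b then δ i j else (if lookup s i then + 0 else laplacian i j)) sj)
                           (cong (λ b → if b then δ i j else laplacian i j) (sym sj))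
    combination : ∀ i j → ∑[ k < m ] (W k j * K i k) ≡ (if lookup s i then - laplacian i j else + 0)
    combination i j = trans (sum-single i (λ k → W k j * K i k) offDiagonal) onDiagonal
      where
      offDiagonal : ∀ k → k ≢ i → W k j * K i k ≡ + 0
      offDiagonal k k≢i with lookup s k
      ... | true = trans (cong (- laplacian k j *_) (δ-≢ (k≢i ∘ sym))) (ℤₚ.*-zeroʳ (- laplacian k j))
      ... | false = refl
      onDiagonal : W i j * K i i ≡ (if lookup s i then - laplacian i j else + 0)
      onDiagonal with lookup s i
      ... | true = trans (cong (- laplacian i j *_) (δ-≡ i)) (ℤₚ.*-identityʳ (- laplacian i j))
      ... | false = refl
    B-other : ∀ i j → lookup s j ≡ false → reduced s i j ≡ + 1 * K i j + ∑[ k < m ] (W k j * K i k)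
    B-other i j sj = begin
      reduced s i j
        ≡⟨ cong (λ b → if b then δ i j else (if lookup s i then + 0 else laplacian i j)) sj ⟩
      (if lookup s i then + 0 else laplacian i j)        ≡⟨ cancel (lookup s i) ⟨
      + 1 * laplacian i j + (if lookup s i then - laplacian i j else + 0)
        ≡⟨ cong₂ (λ x y → + 1 * x + y) (cong (λ b → if b then δ i j else laplacian i j) (sym sj)) (sym (combination i j)) ⟩
      + 1 * K i j + ∑[ k < m ] (W k j * K i k)           ∎
      where
      open ≡.≡-Reasoning
      cancel : ∀ b → + 1 * laplacian i j + (if b then - laplacian i j else + 0) ≡ (if b then + 0 else laplacian i j)
      cancel true = trans (cong (_+ - laplacian i j) (ℤₚ.*-identityˡ (laplacian i j))) (ℤₚ.+-inverseʳ (laplacian i j))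
      cancel false = trans (ℤₚ.+-identityʳ (+ 1 * laplacian i j)) (ℤₚ.*-identityˡ (laplacian i j))
    scaled = Det-columnOperations (lookup s) (+ 1) W W-pivot B-pivot B-other

  Det-withUnitColumns-positive : ∀ s → MeetsAllComponents s → + 0 < Det (withUnitColumns s laplacian)
  Det-withUnitColumns-positive s meets = subst (+ 0 <_) (sym (Det-withUnitColumns≡Det-reduced s))
    (Det-positive (reduced s) (reduced-symmetric s) (reduced-positiveDefinite s meets))

  Det-withUnitColumns-zero : ∀ s r → (∀ j → Connected j r → lookup s j ≡ false) → Det (withUnitColumns s laplacian) ≡ + 0
  Det-withUnitColumns-zero s r missed = begin
    Det K                                          ≡⟨ ℤₚ.*-identityˡ (Det K) ⟨
    + 1 * Det K                                    ≡⟨ cong (_* Det K) (indicator-dec (connected? r r) connected-refl) ⟨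
    indicator r * Det K                            ≡⟨ Det-combination K r indicator ⟨
    Det (setColumn K r combined)                   ≡⟨ Det-zeroColumn r (λ i → trans (setColumn-≡ K r combined i) (combined≡0 i)) ⟩
    + 0                                            ∎
    where
    open ≡.≡-Reasoning
    K = withUnitColumns s laplacian
    indicator : Fin m → ℤ
    indicator k = if does (connected? k r) then + 1 else + 0
    indicator-dec : ∀ {k} (k~r? : Dec (Connected k r)) → Connected k r → (if does k~r? then + 1 else + 0) ≡ + 1
    indicator-dec (yes _) _ = refl
    indicator-dec (no k≁r) k~r = ⊥-elim (k≁r k~r)
    combined : Fin m → ℤ
    combined i = ∑[ k < m ] (indicator k * K i k)
    -- On the missed component K agrees with the Laplacian, and each Laplacian row sums to zero over a component.
    onComponent : ∀ i k → indicator k * K i k ≡ indicator k * laplacian i k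
    onComponent i k with connected? k r
    ... | yes k~r = cong (+ 1 *_) (cong (λ b → if b then δ i k else laplacian i k) (missed k k~r))
    ... | no _ = refl
    combined≡0 : ∀ i → combined i ≡ + 0
    combined≡0 i = trans (sum-cong-≋ {x = λ k → indicator k * K i k} (onComponent i)) (byComponent (connected? i r))
      where
      byComponent : Dec (Connected i r) → ∑[ k < m ] (indicator k * laplacian i k) ≡ + 0
      byComponent (yes i~r) = trans (sum-cong-≋ {x = λ k → indicator k * laplacian i k} termwise) (laplacian-rowSum i)
        where
        termwise : ∀ k → indicator k * laplacian i k ≡ laplacian i k
        termwise k with connected? k r
        ... | yes _ = ℤₚ.*-identityˡ _
        ... | no k≁r = sym (laplacian-unrelated (λ { refl → k≁r i~r })
                                                (λ i~k → k≁r (connected-trans (connected-step (adj-sym i~k) connected-refl) i~r)))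
      byComponent (no i≁r) = sum-zero (λ k → indicator k * laplacian i k) termwise
        where
        termwise : ∀ k → indicator k * laplacian i k ≡ + 0
        termwise k with connected? k r
        ... | yes k~r = trans (ℤₚ.*-identityˡ _)
                              (laplacian-unrelated (λ { refl → i≁r k~r }) (λ i~k → i≁r (connected-step i~k k~r)))
        ... | no _ = refl

module ListLookup where

  open import Data.Fin using (zero; suc)
  open import Data.List using (List; _∷_)
  open import Data.List.Membership.Propositional using (_∈_)
  open import Data.List.Membership.Propositional.Properties using (∈-lookup)
  open import Data.List.Relation.Unary.Any as Any using (Any)
  import Data.List.Relation.Unary.Any.Properties as Anyₚ
  open import Data.List.Relation.Unary.All as All using (All)
  open import Data.List.Relation.Unary.Unique.Propositional using (Unique; _∷_)
  open import Data.Empty using (⊥-elim)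
  open import Relation.Binary.PropositionalEquality using (_≡_; refl; sym; trans; cong; subst)

  lookupL≡lookup : ∀ {A : Set} (xs : List A) i → lookupL xs i ≡ Data.List.lookup xs i
  lookupL≡lookup (x ∷ xs) zero = refl
  lookupL≡lookup (x ∷ xs) (suc i) = lookupL≡lookup xs i

  lookupL-∈ : ∀ {A : Set} (xs : List A) i → lookupL xs i ∈ xs
  lookupL-∈ xs i = subst (_∈ xs) (sym (lookupL≡lookup xs i)) (∈-lookup i)

  lookupL-index : ∀ {A : Set} {x : A} {xs} (x∈xs : x ∈ xs) → lookupL xs (Any.index x∈xs) ≡ x
  lookupL-index {xs = xs} x∈xs = trans (lookupL≡lookup xs _) (sym (Anyₚ.lookup-index x∈xs))

  lookupL-injective : ∀ {A : Set} {xs : List A} → Unique xs → ∀ {i j} → lookupL xs i ≡ lookupL xs j → i ≡ j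
  lookupL-injective {xs = x ∷ xs} _ {zero} {zero} _ = refl
  lookupL-injective {xs = x ∷ xs} (x∉xs ∷ _) {zero} {suc j} x≡ = ⊥-elim (All.lookup x∉xs (lookupL-∈ xs j) x≡)
  lookupL-injective {xs = x ∷ xs} (x∉xs ∷ _) {suc i} {zero} ≡x = ⊥-elim (All.lookup x∉xs (lookupL-∈ xs i) (sym ≡x))
  lookupL-injective {xs = x ∷ xs} (_ ∷ unique) {suc i} {suc j} eq = cong suc (lookupL-injective unique eq)

module HypergraphLaplacian {n} (E : Hypergraph n) (idx : List (Subset n)) (enum : IsEnumI E idx) where

  open import Data.Nat as ℕ using (ℕ; _≤_; _∸_)
  import Data.Nat.Properties as ℕₚ
  open import Data.Integer as ℤ using (ℤ; +_; -_; -1ℤ; _+_; _*_; _^_)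
  import Data.Integer.Properties as ℤₚ
  open import Data.Fin using (Fin; _≟_)
  open import Data.Fin.Subset using (Subset; ∣_∣; Empty)
  import Data.Fin.Subset.Properties as Subsetₚ
  open import Data.Vec using (lookup)
  open import Data.Bool using (true; false; if_then_else_)
  open import Data.List using (List; []; _∷_; length; map; filter)
  import Data.List.Properties as Listₚ
  open import Data.List.Relation.Unary.Any as Any using (Any)
  import Data.List.Relation.Unary.Any.Properties as Anyₚ
  open import Data.List.Relation.Unary.All as All using (All)
  import Data.List.Relation.Unary.All.Properties as Allₚ
  import Data.List.Relation.Unary.AllPairs as AllPairs
  import Data.List.Relation.Unary.AllPairs.Properties as AllPairsₚ
  import Data.List.Relation.Unary.Unique.Propositional.Properties as Uniqueₚ
  open import Data.Product using (∃-syntax; _,_; proj₁; proj₂)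
  open import Data.Sum using (inj₁; inj₂)
  open import Data.Empty using (⊥-elim)
  open import Function using (_∘_)
  open import Relation.Nullary using (yes; no; ¬_; does)
  open import Relation.Binary.PropositionalEquality as ≡ using (_≡_; _≢_; refl; sym; trans; cong; subst)

  open ListLookup

  m : ℕ
  m = length idx

  S : Fin m → Subset n
  S = lookupL idx

  sim-sym : ∀ {A B} → Sim E A B → Sim E B A
  sim-sym {A} {B} (e , e∈E , A≠∅ , B≠∅ , A∩B=∅ , A∪B≡e) =
    e , e∈E , B≠∅ , A≠∅ , subst Empty (Subsetₚ.∩-comm A B) A∩B=∅ , trans (Subsetₚ.∪-comm B A) A∪B≡e

  sim-irrefl : ∀ {A} → ¬ Sim E A A
  sim-irrefl {A} (_ , _ , (x , x∈A) , _ , A∩A=∅ , _) = A∩A=∅ (x , Subsetₚ.x∈p∩q⁺ (x∈A , x∈A))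

  Adj : Fin m → Fin m → Set
  Adj i j = Sim E (S i) (S j)

  open Laplacian Adj (λ i j → sim? E (S i) (S j)) sim-sym public
  open Graph Adj (λ i j → sim? E (S i) (S j)) sim-sym public

  degree≡dstar : ∀ T xs → + length (filter (sim? E T) xs) ≡
                 Determinant.sum ℤₚ.+-*-commutativeRing (λ j → if does (sim? E T (lookupL xs j)) then + 1 else + 0)
  degree≡dstar T [] = refl
  degree≡dstar T (x ∷ xs) with does (sim? E T x)
  ... | true = cong (_+_ (+ 1)) (degree≡dstar T xs)
  ... | false = trans (degree≡dstar T xs) (sym (ℤₚ.+-identityˡ _))

  UL≡laplacian : ∀ i j → UL E idx i j ≡ laplacian i j
  UL≡laplacian i j with i ≟ j
  ... | yes refl = trans (degree≡dstar (S i) idx) (sym (trans (cong (λ a → + 1 * degree i ℤ.- a) (adjacency-¬adj sim-irrefl))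
                                                            (trans (ℤₚ.+-identityʳ _) (ℤₚ.*-identityˡ _))))
  ... | no _ with sim? E (S i) (S j)
  ...   | yes _ = refl
  ...   | no _ = refl

  S-injective : ∀ {i j} → S i ≡ S j → i ≡ j
  S-injective = lookupL-injective (proj₁ enum)

  S-inI : ∀ i → InI E (S i)
  S-inI i = proj₁ (proj₂ enum (S i)) (lookupL-∈ idx i)

  position : ∀ {T} → InI E T → ∃[ i ] S i ≡ T
  position {T} T∈I = let T∈idx = proj₂ (proj₂ enum T) T∈I in Any.index T∈idx , lookupL-index T∈idx

  walk⇒connected : ∀ {T U xs} → Walk E T U xs → ∀ {a b} → S a ≡ T → S b ≡ U → Connected a b
  walk⇒connected stop {a} Sa≡T Sb≡T = subst (Connected a) (S-injective (trans Sa≡T (sym Sb≡T))) connected-refl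
  walk⇒connected (step {S = T} T~V walk) Sa≡T Sb≡U with k , Sk≡V ← position (inj₂ (T , sim-sym T~V)) =
    connected-step (≡.subst₂ (Sim E) (sym Sa≡T) (sym Sk≡V) T~V) (walk⇒connected walk Sk≡V Sb≡U)

  ρ⇒connected : ∀ a b → ρ E (S a) (S b) → Connected a b
  ρ⇒connected a b (inj₁ Sa≡Sb) = subst (Connected a) (S-injective Sa≡Sb) connected-refl
  ρ⇒connected a b (inj₂ (_ , walk , _)) = walk⇒connected walk refl refl

  path⇒walk : ∀ {a b ys} → Path a b ys → Walk E (S a) (S b) (map S ys)
  path⇒walk stop = stop
  path⇒walk (step a~k path) = step a~k (path⇒walk path)

  connected⇒ρ : ∀ {a b} → Connected a b → ρ E (S a) (S b)
  connected⇒ρ (_ , path) = let ys , simple , unique = eraseLoops path in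
    inj₂ (map S ys , path⇒walk simple , Uniqueₚ.map⁺ S-injective unique)

  #components : ℕ
  #components = length representatives

  numClasses : NumClasses E #components
  numClasses = map S representatives , Listₚ.length-map S representatives ,
    Allₚ.map⁺ (All.tabulate λ {i} _ → S-inI i) ,
    AllPairsₚ.map⁺ (AllPairs.map (λ {a} {b} a≁b → a≁b ∘ ρ⇒connected a b) representatives-disconnected) ,
    covered
    where
    covered : ∀ T → InI E T → Any (ρ E T) (map S representatives)
    covered T T∈I with i , refl ← position T∈I = Anyₚ.map⁺ (Any.map connected⇒ρ (representatives-cover i))

  open Determinant ℤₚ.+-*-commutativeRing using (Det; Det-cong; δ; sumSubsets; sumSubsets-cong)
  open CharacteristicPolynomial using (withUnitColumns; coeff-charPoly; monomialCoeff; monomialCoeff-≡; monomialCoeff-≢)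
  open IntegerInequalities using (sumSubsets-zero; sumSubsets-positive)

  principalMinor : Subset m → ℤ
  principalMinor s = Det (withUnitColumns s laplacian)

  coeff-charPoly-UL : ∀ k → coeff (charPoly m (UL E idx)) k ≡
                      -1ℤ ^ (m ∸ k) * sumSubsets m (λ s → monomialCoeff ∣ s ∣ k (principalMinor s))
  coeff-charPoly-UL k = trans (coeff-charPoly m (UL E idx) k)
    (cong (-1ℤ ^ (m ∸ k) *_) (sumSubsets-cong m λ s → cong (monomialCoeff ∣ s ∣ k) (Det-cong λ i j →
      cong (λ x → if lookup s j then δ i j else x) (UL≡laplacian i j))))

  principalMinor-small : ∀ s → ∣ s ∣ ℕ.< #components → principalMinor s ≡ + 0
  principalMinor-small s small with meetsAllComponents? s
  ... | yes meets = ⊥-elim (ℕₚ.<⇒≱ small (#components≤∣∣ s meets))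
  ... | no misses = let r , missed = missesComponent s misses in Det-withUnitColumns-zero s r missed

  principalMinor-nonneg : ∀ s → + 0 ℤ.≤ principalMinor s
  principalMinor-nonneg s with meetsAllComponents? s
  ... | yes meets = ℤₚ.<⇒≤ (Det-withUnitColumns-positive s meets)
  ... | no misses = let r , missed = missesComponent s misses in ℤₚ.≤-reflexive (sym (Det-withUnitColumns-zero s r missed))

  lowerCoefficients : ∀ k → k ℕ.< #components → coeff (charPoly m (UL E idx)) k ≡ + 0
  lowerCoefficients k k<c = trans (coeff-charPoly-UL k)
    (trans (cong (-1ℤ ^ (m ∸ k) *_) (sumSubsets-zero m _ term≡0)) (ℤₚ.*-zeroʳ (-1ℤ ^ (m ∸ k))))
    where
    term≡0 : ∀ s → monomialCoeff ∣ s ∣ k (principalMinor s) ≡ + 0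
    term≡0 s with ∣ s ∣ ℕ.≟ k
    ... | yes refl = trans (monomialCoeff-≡ {∣ s ∣} _ refl) (principalMinor-small s k<c)
    ... | no ∣s∣≢k = monomialCoeff-≢ _ ∣s∣≢k

  leadingCoefficient : coeff (charPoly m (UL E idx)) #components ≢ + 0
  leadingCoefficient coeff≡0
    with ℤₚ.i*j≡0⇒i≡0∨j≡0 (-1ℤ ^ (m ∸ #components)) (trans (sym (coeff-charPoly-UL #components)) coeff≡0)
  ... | inj₁ sign≡0 with () ← ℤₚ.i^n≡0⇒i≡0 -1ℤ (m ∸ #components) sign≡0
  ... | inj₂ sum≡0 = ℤₚ.<-irrefl (sym sum≡0) (sumSubsets-positive m _ term≥0 transversal transversal-term>0)
    where
    term≥0 : ∀ s → + 0 ℤ.≤ monomialCoeff ∣ s ∣ #components (principalMinor s)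
    term≥0 s with ∣ s ∣ ℕ.≟ #components
    ... | yes ∣s∣≡c = subst (+ 0 ℤ.≤_) (sym (monomialCoeff-≡ _ ∣s∣≡c)) (principalMinor-nonneg s)
    ... | no ∣s∣≢c = ℤₚ.≤-reflexive (sym (monomialCoeff-≢ _ ∣s∣≢c))
    transversal-term>0 : + 0 ℤ.< monomialCoeff ∣ transversal ∣ #components (principalMinor transversal)
    transversal-term>0 = subst (+ 0 ℤ.<_) (sym (monomialCoeff-≡ _ ∣transversal∣))
                               (Det-withUnitColumns-positive transversal transversal-meets)

  algebraicMultiplicity : AlgMult0 m (UL E idx) #components
  algebraicMultiplicity = lowerCoefficients , leadingCoefficient

open import Data.Nat using (ℕ; _≤_)
open import Data.Product using (_×_; ∃-syntax; _,_)

mainTheorem6 : (n : ℕ) → 1 ≤ n → (E : Hypergraph n) → Simple E →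
    (idx : List (Subset n)) → IsEnumI E idx →
    ∃[ k ] (AlgMult0 (length idx) (UL E idx) k × NumClasses E k)
mainTheorem6 n _ E _ idx enum = #components , algebraicMultiplicity , numClasses
  where open HypergraphLaplacian E idx enum
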